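{- For integers $1\le k_1\le k_2\le N-3$, $$W_1(N,k_1,k_2)=\theta^{N-k_1-2}P_{k_1}(P_{N-2})!\Big(\theta^{N-k_2+1}+\theta^{N-k_2+1}P_{k_2-1}\sum_{i=k_2}^{N-2}\frac1{P_i}+\sum_{i=k_1}^{k_2}\frac{P_{N-i-1}}{P_i}+\theta P_{k_2-1}\sum_{i=k_2}^{N-3}\frac{\theta^{i-k_2}P_{N-i-2}}{P_iP_{i+1}}\Big).$$ Moreover, $$W_1(k_2+1,k_1,k_2)=(P_{k_2-1})!\,P_{k_1}\,\theta^{k_2-k_1-1}\Big(\theta^2+\sum_{i=k_1}^{k_2-1}\frac{P_{k_2-i}}{P_i}\Big)$$ and, with $M=k_2+2$, $$W_1(M,k_1,k_2)=\theta^{M-k_1-2}P_{k_1}(P_{M-2})!\Big(\theta^{M-k_2+1}+\theta^{M-k_2+1}\frac{P_{k_2-1}}{P_{k_2}}+\sum_{i=k_1}^{k_2}\frac{P_{M-i-1}}{P_i}\Big).$$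
   Context: Let $\theta>0$. $\mathrm{inv}(\pi)$ is the number of pairs $i<j$ with $\pi_i>\pi_j$. $P_n=1+\theta+\cdots+\theta^{n-1}$, $(P_n)!=P_n\cdots P_1$, $(P_0)!=1$. For $\pi\in S_n$, position $i$ is a left-to-right maximum if $\pi_i>\pi_j$ for all $j<i$, and a left-to-right second maximum if exactly one $j<i$ has $\pi_j>\pi_i$. The $(k_1,k_2)$-strategy accepts the first position $i$ such that either $i>k_1$ and $i$ is a left-to-right maximum, or $i>k_2$ and $i$ is a left-to-right second maximum (if none, the last position is accepted). $\pi\in S_n$ is $(k_1,k_2)$-winnable if the accepted position holds value $n-1$, and $W_1(n,k_1,k_2)=\sum_{\pi\in S_n\ (k_1,k_2)\text{ -winnable}}\theta^{\mathrm{inv}(\pi)}$.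
   Formalization: The parameter θ ranges over the positive rationals instead of the positive reals. -}

module Defs where

open import Data.Bool using (Bool; true; false; _∧_; _∨_; not; if_then_else_)
open import Data.Nat as ℕ using (ℕ; zero; suc; _<ᵇ_; _≡ᵇ_)
open import Data.List using (List; []; _∷_; filter; map; concatMap; foldr; applyUpTo)
open import Data.Integer using (ℤ; +_; -[1+_])
open import Data.Rational as ℚ using (ℚ; 0ℚ; 1ℚ; _+_; _*_; 1/_; ≢-nonZero)
open import Relation.Nullary using (yes; no)
open import Relation.Nullary.Decidable using (does)

-- Permutations of {1,…,n}, in one-line notation π₁ π₂ … πₙ (as lists).

words : ℕ → ℕ → List (List ℕ)
words n zero    = [] ∷ []
words n (suc k) = concatMap (λ w → map (λ a → a ∷ w) (applyUpTo suc n)) (words n k)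

notIn : ℕ → List ℕ → Bool
notIn a []       = true
notIn a (b ∷ bs) = not (a ≡ᵇ b) ∧ notIn a bs

distinct : List ℕ → Bool
distinct []       = true
distinct (a ∷ as) = notIn a as ∧ distinct as

S : ℕ → List (List ℕ)
S n = filter (λ w → Data.Bool._≟_ (distinct w) true) (words n n)

#greater : ℕ → List ℕ → ℕ
#greater x []       = 0
#greater x (y ∷ ys) = if x <ᵇ y then suc (#greater x ys) else #greater x ys

#less : ℕ → List ℕ → ℕ
#less x []       = 0
#less x (y ∷ ys) = if y <ᵇ x then suc (#less x ys) else #less x ys

inv : List ℕ → ℕ
inv []       = 0
inv (a ∷ as) = #less a as ℕ.+ inv as

-- Positions are 1-based.  At position i with
-- prefix pre = π_{i-1} … π₁ (reversed; order irrelevant for counting),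
-- i is a left-to-right maximum iff no earlier entry exceeds π_i, and a
-- left-to-right second maximum iff exactly one earlier entry exceeds π_i.

acceptHere : ℕ → ℕ → ℕ → List ℕ → ℕ → Bool
acceptHere k₁ k₂ i pre x =
  ((k₁ <ᵇ i) ∧ (#greater x pre ≡ᵇ 0)) ∨ ((k₂ <ᵇ i) ∧ (#greater x pre ≡ᵇ 1))

-- value at the accepted position: the first position satisfying the
-- acceptance rule; if there is none, the last position.
-- (The empty permutation, n = 0, is given the dummy value 0.)
go : ℕ → ℕ → ℕ → List ℕ → List ℕ → ℕ
go k₁ k₂ i pre []          = 0
go k₁ k₂ i pre (x ∷ [])    = x
go k₁ k₂ i pre (x ∷ y ∷ r) =
  if acceptHere k₁ k₂ i pre x then x else go k₁ k₂ (suc i) (x ∷ pre) (y ∷ r)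

acceptedValue : ℕ → ℕ → List ℕ → ℕ
acceptedValue k₁ k₂ π = go k₁ k₂ 1 [] π

winnable : ℕ → ℕ → ℕ → List ℕ → Bool
winnable n k₁ k₂ π = acceptedValue k₁ k₂ π ≡ᵇ (n ℕ.∸ 1)

pow : ℚ → ℕ → ℚ
pow θ zero    = 1ℚ
pow θ (suc n) = θ * pow θ n

-- total reciprocal (1/0 := 0); only ever applied to nonzero values below
recip : ℚ → ℚ
recip q with q ℚ.≟ 0ℚ
... | yes _  = 0ℚ
... | no q≢0 = (1/ q) {{≢-nonZero q≢0}}

powℤ : ℚ → ℤ → ℚ
powℤ θ (+ n)    = pow θ n
powℤ θ -[1+ n ] = recip (pow θ (suc n))

-- Σ_{i=a}^{b} f i  (empty, i.e. 0, when b < a)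
Σ[_to_] : ℕ → ℕ → (ℕ → ℚ) → ℚ
Σ[ a to b ] f = foldr _+_ 0ℚ (applyUpTo (λ j → f (a ℕ.+ j)) (suc b ℕ.∸ a))

P : ℚ → ℕ → ℚ
P θ n = foldr _+_ 0ℚ (applyUpTo (pow θ) n)

P! : ℚ → ℕ → ℚ
P! θ zero    = 1ℚ
P! θ (suc n) = P θ (suc n) * P! θ n

W₁ : ℚ → ℕ → ℕ → ℕ → ℚ
W₁ θ n k₁ k₂ =
  foldr _+_ 0ℚ
    (map (λ π → pow θ (inv π))
         (filter (λ π → Data.Bool._≟_ (winnable n k₁ k₂ π) true) (S n)))

-- Classify an arrangement of distinct values by its last entry x.  The rank of x among the
-- earlier entries is what it adds to the inversions and all the strategy looks at in the last
-- position.  Hence the θ^inv-weighted numbers of arrangements of n values in which nothing, the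
-- largest value, or the second largest value has been accepted depend only on n, and obey
-- first-order recurrences whose coefficients are geometric sums Σ_{g<n} θ^g = P_n.  Solving them
-- in the regimes n ≤ k₁, k₁ < n ≤ k₂ and k₂ < n gives the products of P's and the sums of 1/P_i,
-- P_j/P_i and θ^j/(P_i P_{i+1}) of the theorem, for the value n - 1 to be picked is the second
-- largest of {1, …, n}.  Everything is multiplied by θ to clear the θ^(-1) occurring at N = k₂ + 1.

module Submission where

open import Defs
open import Data.Bool as Bool using (Bool; true; false; _∧_; _∨_; not; if_then_else_)
open import Data.Bool.Properties using (if-float; ∧-zeroʳ; ∨-zeroʳ)
open import Data.Empty using (⊥-elim)
open import Data.Integer as ℤ using (+_; _-_; _⊖_)
import Data.Integer.Properties as ℤP
open import Data.List
  using (List; []; _∷_; _++_; [_]; _∷ʳ_; _ʳ++_; map; concatMap; filter; foldr; length; applyUpTo; applyDownFrom; initLast; _∷ʳ′_)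
open import Data.List.Membership.Propositional using (_∈_; _∉_; find; lose)
open import Data.List.Membership.Propositional.Properties
  using (∈-map⁻; ∈-map⁺; ∈-++⁺ʳ; ∈-concatMap⁻; ∈-concatMap⁺; ∈-filter⁺; ∈-filter⁻; ∈-∃++)
open import Data.List.Membership.Propositional.Properties.WithK using (unique∧set⇒bag)
open import Data.List.Properties
  using (map-∘; map-id; ∷-injective; length-applyUpTo; ∷ʳ-injectiveˡ; ∷ʳ-injectiveʳ; length-applyDownFrom; reverse-applyUpTo)
open import Data.List.Relation.Binary.BagAndSetEquality using (∼bag⇒↭)
open import Data.List.Relation.Binary.Permutation.Propositional as ↭ using (_↭_; ↭-sym; ↭-refl; ↭-trans; ↭⇒↭ₛ)
open import Data.List.Relation.Binary.Permutation.Propositional.Properties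
  using (↭-length; ∷↭∷ʳ; ∈-resp-↭; All-resp-↭; drop-∷; shift; filter-↭; ↭-reverse)
import Data.List.Relation.Binary.Permutation.Setoid.Properties as ↭ₛ
open import Data.List.Relation.Unary.All as All using (All; []; _∷_)
open import Data.List.Relation.Unary.AllPairs as AllPairs using (AllPairs; []; _∷_)
open import Data.List.Relation.Unary.Any using (here; there)
open import Data.List.Relation.Unary.Unique.Propositional using (Unique)
import Data.List.Relation.Unary.Unique.Propositional.Properties as Unique
open import Data.Maybe using (Maybe; just; nothing; fromMaybe; _<∣>_)
open import Data.Nat as ℕ using (ℕ; zero; suc; _<ᵇ_; _≡ᵇ_; _∸_; _+_; _≤_; _>_; z≤n; s≤s; _<?_; _≟_)
import Data.Nat.Properties as ℕP
open import Algebra.Properties.CommutativeSemigroup ℕP.+-commutativeSemigroup using (interchange)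
open import Data.List.Membership.DecPropositional ℕ._≟_ using (_∈?_)
open import Data.Product as Prod using (_×_; _,_; proj₁; proj₂; ∃)
open import Data.Rational as ℚ using (ℚ; 0ℚ; 1ℚ; _*_; _<_) renaming (_+_ to _+ℚ_)
import Data.Rational.Properties as ℚP
open import Data.Rational.Solver using (module +-*-Solver)
open import Function using (_∘_; case_of_)
open import Function.Bundles using (mk⇔)
open import Relation.Binary.PropositionalEquality hiding ([_])
open import Relation.Nullary using (¬_; yes; no)
open import Relation.Nullary.Decidable using (dec-true; dec-false)

open +-*-Solver

∑ : {A : Set} → List A → (A → ℚ) → ℚ
∑ []       f = 0ℚ
∑ (x ∷ xs) f = f x +ℚ ∑ xs f

∑-++ : {A : Set} (xs ys : List A) (f : A → ℚ) → ∑ (xs ++ ys) f ≡ ∑ xs f +ℚ ∑ ys f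
∑-++ []       ys f = sym (ℚP.+-identityˡ _)
∑-++ (x ∷ xs) ys f = trans (cong (f x +ℚ_) (∑-++ xs ys f)) (sym (ℚP.+-assoc (f x) _ _))

∑-map : {A B : Set} (g : A → B) (xs : List A) (f : B → ℚ) → ∑ (map g xs) f ≡ ∑ xs (f ∘ g)
∑-map g []       f = refl
∑-map g (x ∷ xs) f = cong (f (g x) +ℚ_) (∑-map g xs f)

∑-concatMap : {A B : Set} (g : A → List B) (xs : List A) (f : B → ℚ) →
              ∑ (concatMap g xs) f ≡ ∑ xs (λ x → ∑ (g x) f)
∑-concatMap g []       f = refl
∑-concatMap g (x ∷ xs) f =
  trans (∑-++ (g x) (concatMap g xs) f) (cong (∑ (g x) f +ℚ_) (∑-concatMap g xs f))

∑-cong : {A : Set} (xs : List A) {f g : A → ℚ} → (∀ {x} → x ∈ xs → f x ≡ g x) → ∑ xs f ≡ ∑ xs g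
∑-cong []       f≡g = refl
∑-cong (x ∷ xs) f≡g = cong₂ _+ℚ_ (f≡g (here refl)) (∑-cong xs (f≡g ∘ there))

∑-+ : {A : Set} (xs : List A) (f g : A → ℚ) → ∑ xs (λ x → f x +ℚ g x) ≡ ∑ xs f +ℚ ∑ xs g
∑-+ []       f g = refl
∑-+ (x ∷ xs) f g rewrite ∑-+ xs f g =
  solve 4 (λ a b c d → (a :+ b) :+ (c :+ d) := (a :+ c) :+ (b :+ d)) refl (f x) (g x) (∑ xs f) (∑ xs g)

∑-*ˡ : {A : Set} (xs : List A) (c : ℚ) (f : A → ℚ) → ∑ xs (λ x → c * f x) ≡ c * ∑ xs f
∑-*ˡ []       c f = sym (ℚP.*-zeroʳ c)
∑-*ˡ (x ∷ xs) c f rewrite ∑-*ˡ xs c f = sym (ℚP.*-distribˡ-+ c (f x) _)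

∑-*ʳ : {A : Set} (xs : List A) (c : ℚ) (f : A → ℚ) → ∑ xs (λ x → f x * c) ≡ ∑ xs f * c
∑-*ʳ []       c f = sym (ℚP.*-zeroˡ c)
∑-*ʳ (x ∷ xs) c f rewrite ∑-*ʳ xs c f = sym (ℚP.*-distribʳ-+ c (f x) _)

∑-zero : {A : Set} (xs : List A) → ∑ xs (λ _ → 0ℚ) ≡ 0ℚ
∑-zero []       = refl
∑-zero (_ ∷ xs) = trans (ℚP.+-identityˡ _) (∑-zero xs)

indicator : Bool → ℚ
indicator true  = 1ℚ
indicator false = 0ℚ

∑-filter : {A : Set} (b : A → Bool) (f : A → ℚ) (xs : List A) →
           foldr _+ℚ_ 0ℚ (map f (filter (λ x → b x Bool.≟ true) xs)) ≡ ∑ xs (λ x → f x * indicator (b x))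
∑-filter b f []       = refl
∑-filter b f (x ∷ xs) with b x
... | true  = cong₂ _+ℚ_ (sym (ℚP.*-identityʳ (f x))) (∑-filter b f xs)
... | false = trans (∑-filter b f xs) (sym (trans (cong (_+ℚ _) (ℚP.*-zeroʳ (f x))) (ℚP.+-identityˡ _)))

∑-↭ : {A : Set} {xs ys : List A} (f : A → ℚ) → xs ↭ ys → ∑ xs f ≡ ∑ ys f
∑-↭ f ↭.refl          = refl
∑-↭ f (↭.prep x p)     = cong (f x +ℚ_) (∑-↭ f p)
∑-↭ f (↭.swap x y p) rewrite ∑-↭ f p = solve 3 (λ a b c → a :+ (b :+ c) := b :+ (a :+ c)) refl (f x) (f y) _
∑-↭ f (↭.trans p q)    = trans (∑-↭ f p) (∑-↭ f q)

Σ< : ℕ → (ℕ → ℚ) → ℚ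
Σ< n f = foldr _+ℚ_ 0ℚ (applyUpTo f n)

Σ<-*ˡ : ∀ n c f → Σ< n (λ j → c * f j) ≡ c * Σ< n f
Σ<-*ˡ zero    c f = sym (ℚP.*-zeroʳ c)
Σ<-*ˡ (suc n) c f rewrite Σ<-*ˡ n c (f ∘ suc) = sym (ℚP.*-distribˡ-+ c (f 0) _)

Σ<-+ : ∀ n f g → Σ< n (λ j → f j +ℚ g j) ≡ Σ< n f +ℚ Σ< n g
Σ<-+ zero    f g = refl
Σ<-+ (suc n) f g rewrite Σ<-+ n (f ∘ suc) (g ∘ suc) =
  solve 4 (λ a b c d → (a :+ b) :+ (c :+ d) := (a :+ c) :+ (b :+ d)) refl (f 0) (g 0) (Σ< n (f ∘ suc)) (Σ< n (g ∘ suc))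

Σ<-cong : ∀ n {f g} → (∀ j → n > j → f j ≡ g j) → Σ< n f ≡ Σ< n g
Σ<-cong zero    f≡g = refl
Σ<-cong (suc n) f≡g = cong₂ _+ℚ_ (f≡g 0 (s≤s z≤n)) (Σ<-cong n (λ j j<n → f≡g (suc j) (s≤s j<n)))

Σ<-suc : ∀ n f → Σ< (suc n) f ≡ Σ< n f +ℚ f n
Σ<-suc zero    f = ℚP.+-comm (f 0) 0ℚ
Σ<-suc (suc n) f rewrite Σ<-suc n (f ∘ suc) = sym (ℚP.+-assoc (f 0) _ _)

Σ[]-as-Σ< : ∀ m n {c} (f g : ℕ → ℚ) → suc n ∸ m ≡ c → (∀ j → f (m + j) ≡ g j) → Σ[ m to n ] f ≡ Σ< c g
Σ[]-as-Σ< m n f g refl f≡g = Σ<-cong (suc n ∸ m) (λ j _ → f≡g j)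

pow-+ : ∀ θ m n → pow θ (m + n) ≡ pow θ m * pow θ n
pow-+ θ zero    n = sym (ℚP.*-identityˡ _)
pow-+ θ (suc m) n rewrite pow-+ θ m n = sym (ℚP.*-assoc θ _ _)

P-suc : ∀ θ n → P θ (suc n) ≡ 1ℚ +ℚ θ * P θ n
P-suc θ n = cong (1ℚ +ℚ_) (Σ<-*ˡ n θ (pow θ))

Σ<-P-suc : ∀ θ m n (f : ℕ → ℚ) → n ≤ suc m →
  Σ< n (λ j → P θ (suc m ∸ j) * f j) ≡ Σ< n f +ℚ θ * Σ< n (λ j → P θ (m ∸ j) * f j)
Σ<-P-suc θ m n f n≤1+m = begin
  Σ< n (λ j → P θ (suc m ∸ j) * f j)              ≡⟨ Σ<-cong n split ⟩
  Σ< n (λ j → f j +ℚ θ * (P θ (m ∸ j) * f j))     ≡⟨ Σ<-+ n f (λ j → θ * (P θ (m ∸ j) * f j)) ⟩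
  Σ< n f +ℚ Σ< n (λ j → θ * (P θ (m ∸ j) * f j))  ≡⟨ cong (Σ< n f +ℚ_) (Σ<-*ˡ n θ (λ j → P θ (m ∸ j) * f j)) ⟩
  Σ< n f +ℚ θ * Σ< n (λ j → P θ (m ∸ j) * f j)    ∎
  where
  open ≡-Reasoning
  split : ∀ j → n > j → P θ (suc m ∸ j) * f j ≡ f j +ℚ θ * (P θ (m ∸ j) * f j)
  split j j<n rewrite ℕP.+-∸-assoc 1 (ℕP.≤-pred (ℕP.≤-trans j<n n≤1+m)) | P-suc θ (m ∸ j) =
    solve 3 (λ t p x → (con 1ℚ :+ t :* p) :* x := x :+ t :* (p :* x)) refl θ (P θ (m ∸ j)) (f j)

Σ<-P-last : ∀ θ m (f : ℕ → ℚ) → Σ< (suc m) (λ j → P θ (m ∸ j) * f j) ≡ Σ< m (λ j → P θ (m ∸ j) * f j)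
Σ<-P-last θ m f = begin
  Σ< (suc m) (λ j → P θ (m ∸ j) * f j)                 ≡⟨ Σ<-suc m (λ j → P θ (m ∸ j) * f j) ⟩
  Σ< m (λ j → P θ (m ∸ j) * f j) +ℚ P θ (m ∸ m) * f m  ≡⟨ cong (λ n → Σ< m (λ j → P θ (m ∸ j) * f j) +ℚ P θ n * f m) (ℕP.n∸n≡0 m) ⟩
  Σ< m (λ j → P θ (m ∸ j) * f j) +ℚ 0ℚ * f m           ≡⟨ solve 2 (λ s x → s :+ con 0ℚ :* x := s) refl (Σ< m (λ j → P θ (m ∸ j) * f j)) (f m) ⟩
  Σ< m (λ j → P θ (m ∸ j) * f j)                       ∎
  where open ≡-Reasoning

recip-inverseʳ : ∀ x → x ≢ 0ℚ → x * recip x ≡ 1ℚ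
recip-inverseʳ x x≢0 with x ℚ.≟ 0ℚ
... | yes x≡0 = ⊥-elim (x≢0 x≡0)
... | no  x≢0′ = ℚP.*-inverseʳ x {{ℚ.≢-nonZero x≢0′}}

recip-unique : ∀ z w → z ≢ 0ℚ → w * z ≡ 1ℚ → w ≡ recip z
recip-unique z w z≢0 wz≡1 = begin
  w                   ≡⟨ ℚP.*-identityʳ w ⟨
  w * 1ℚ             ≡⟨ cong (w *_) (recip-inverseʳ z z≢0) ⟨
  w * (z * recip z)  ≡⟨ ℚP.*-assoc w z _ ⟨
  w * z * recip z    ≡⟨ cong (_* recip z) wz≡1 ⟩
  1ℚ * recip z       ≡⟨ ℚP.*-identityˡ _ ⟩
  recip z            ∎
  where open ≡-Reasoning

recip-* : ∀ x y → x ≢ 0ℚ → y ≢ 0ℚ → recip (x * y) ≡ recip x * recip y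
recip-* x y x≢0 y≢0 = sym (recip-unique (x * y) (recip x * recip y) xy≢0 inverse)
  where
  inverse : recip x * recip y * (x * y) ≡ 1ℚ
  inverse = trans (solve 4 (λ a b c d → (a :* b) :* (c :* d) := (c :* a) :* (d :* b)) refl (recip x) (recip y) x y)
                  (cong₂ _*_ (recip-inverseʳ x x≢0) (recip-inverseʳ y y≢0))
  xy≢0 : x * y ≢ 0ℚ
  xy≢0 xy≡0 = ℚP.1≢0 (trans (sym inverse) (trans (cong (recip x * recip y *_) xy≡0) (ℚP.*-zeroʳ (recip x * recip y))))

*-cancelˡ-≢0 : ∀ c {x y} → c ≢ 0ℚ → c * x ≡ c * y → x ≡ y
*-cancelˡ-≢0 c {x} {y} c≢0 cx≡cy = begin
  x                     ≡⟨ ℚP.*-identityˡ x ⟨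
  1ℚ * x             ≡⟨ cong (_* x) r*c≡1 ⟨
  recip c * c * x    ≡⟨ ℚP.*-assoc (recip c) c x ⟩
  recip c * (c * x)  ≡⟨ cong (recip c *_) cx≡cy ⟩
  recip c * (c * y)  ≡⟨ ℚP.*-assoc (recip c) c y ⟨
  recip c * c * y    ≡⟨ cong (_* y) r*c≡1 ⟩
  1ℚ * y             ≡⟨ ℚP.*-identityˡ y ⟩
  y                     ∎
  where
  open ≡-Reasoning
  r*c≡1 : recip c * c ≡ 1ℚ
  r*c≡1 = trans (ℚP.*-comm (recip c) c) (recip-inverseʳ c c≢0)

module Positivity (θ : ℚ) (θ>0 : 0ℚ < θ) where

  θ≢0 : θ ≢ 0ℚ
  θ≢0 θ≡0 = ℚP.<⇒≢ θ>0 (sym θ≡0)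

  pow≡θ*powℤ[-1] : ∀ b → pow θ b ≡ θ * powℤ θ (b ⊖ 1)
  pow≡θ*powℤ[-1] zero    = sym (trans (cong (λ x → θ * recip x) (ℚP.*-identityʳ θ)) (recip-inverseʳ θ θ≢0))
  pow≡θ*powℤ[-1] (suc b) = refl

  P-nonNeg : ∀ n → 0ℚ ℚ.≤ P θ n
  P-pos : ∀ n → 0ℚ < P θ (suc n)

  P-nonNeg zero    = ℚP.≤-refl
  P-nonNeg (suc n) = ℚP.<⇒≤ (P-pos n)

  P-pos n rewrite P-suc θ n =
    subst (_< 1ℚ +ℚ θ * P θ n) (ℚP.+-identityʳ 0ℚ)
      (ℚP.+-mono-<-≤ (ℚP.positive⁻¹ 1ℚ)
        (subst (ℚ._≤ θ * P θ n) (ℚP.*-zeroʳ θ) (ℚP.*-monoˡ-≤-nonNeg θ {{ℚ.nonNegative (ℚP.<⇒≤ θ>0)}} (P-nonNeg n))))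

  P≢0 : ∀ n → P θ (suc n) ≢ 0ℚ
  P≢0 n P≡0 = ℚP.<⇒≢ (P-pos n) (sym P≡0)

  P*P⁻¹ : ∀ n → P θ (suc n) * recip (P θ (suc n)) ≡ 1ℚ
  P*P⁻¹ n = recip-inverseʳ (P θ (suc n)) (P≢0 n)

  *-P*P⁻¹ : ∀ n x → x * (P θ (suc n) * recip (P θ (suc n))) ≡ x
  *-P*P⁻¹ n x = trans (cong (x *_) (P*P⁻¹ n)) (ℚP.*-identityʳ x)

#greater≡count : ∀ y xs → #greater y xs ≡ length (filter (y <?_) xs)
#greater≡count y []       = refl
#greater≡count y (x ∷ xs) with y <ᵇ x
... | true  = cong suc (#greater≡count y xs)
... | false = #greater≡count y xs

#greater-↭ : ∀ y {xs ys} → xs ↭ ys → #greater y xs ≡ #greater y ys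
#greater-↭ y {xs} {ys} p = begin
  #greater y xs               ≡⟨ #greater≡count y xs ⟩
  length (filter (y <?_) xs)  ≡⟨ ↭-length (filter-↭ (y <?_) p) ⟩
  length (filter (y <?_) ys)  ≡⟨ #greater≡count y ys ⟨
  #greater y ys               ∎
  where open ≡-Reasoning

#greater-∷ : ∀ y x xs → #greater y (x ∷ xs) ≡ #less x [ y ] + #greater y xs
#greater-∷ y x xs with y <ᵇ x
... | true  = refl
... | false = refl

#less-++ : ∀ a xs ys → #less a (xs ++ ys) ≡ #less a xs + #less a ys
#less-++ a []       ys = refl
#less-++ a (x ∷ xs) ys with x <ᵇ a
... | true  = cong suc (#less-++ a xs ys)
... | false = #less-++ a xs ys

inv-∷ʳ : ∀ σ x → inv (σ ∷ʳ x) ≡ inv σ + #greater x σ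
inv-∷ʳ []      x = refl
inv-∷ʳ (a ∷ σ) x = begin
  #less a (σ ∷ʳ x) + inv (σ ∷ʳ x)                       ≡⟨ cong₂ _+_ (#less-++ a σ [ x ]) (inv-∷ʳ σ x) ⟩
  (#less a σ + #less a [ x ]) + (inv σ + #greater x σ)  ≡⟨ interchange (#less a σ) _ _ _ ⟩
  (#less a σ + inv σ) + (#less a [ x ] + #greater x σ)  ≡⟨ cong (λ g → inv (a ∷ σ) + g) (#greater-∷ x a σ) ⟨
  inv (a ∷ σ) + #greater x (a ∷ σ)                      ∎
  where open ≡-Reasoning

#greater-of-max : ∀ y {L} → All (y >_) L → #greater y L ≡ 0
#greater-of-max y []               = refl
#greater-of-max y {x ∷ L} (y>x ∷ a) rewrite dec-false (y <? x) (ℕP.<-asym y>x) = #greater-of-max y a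

#greater-∷-larger : ∀ y v L → v > y → #greater y (v ∷ L) ≡ suc (#greater y L)
#greater-∷-larger y v L y<v rewrite dec-true (y <? v) y<v = refl

Unique-resp-↭ : {A : Set} {xs ys : List A} → xs ↭ ys → Unique xs → Unique ys
Unique-resp-↭ {A} p = ↭ₛ.Unique-resp-↭ (setoid A) (↭⇒↭ₛ p)

Unique-⇔-↭ : {A : Set} {xs ys : List A} → Unique xs → Unique ys →
             (∀ {x} → x ∈ xs → x ∈ ys) → (∀ {x} → x ∈ ys → x ∈ xs) → xs ↭ ys
Unique-⇔-↭ xs! ys! xs⊆ys ys⊆xs = ∼bag⇒↭ (unique∧set⇒bag xs! ys! (mk⇔ xs⊆ys ys⊆xs))

Unique-concatMap : {A B C : Set} (key : A → C) (g : A → List B) (xs : List A) →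
                   Unique (map key xs) → (∀ {x} → x ∈ xs → Unique (g x)) →
                   (∀ {x y z} → x ∈ xs → y ∈ xs → z ∈ g x → z ∈ g y → key x ≡ key y) →
                   Unique (concatMap g xs)
Unique-concatMap key g []       _          _      _        = []
Unique-concatMap key g (x ∷ xs) (x∉ ∷ xs!) g-uniq g-disj =
  Unique.++⁺ (g-uniq (here refl)) (Unique-concatMap key g xs xs! (g-uniq ∘ there) (λ x∈ y∈ → g-disj (there x∈) (there y∈)))
    disjoint
  where
  disjoint : ∀ {z} → ¬ (z ∈ g x × z ∈ concatMap g xs)
  disjoint (z∈gx , z∈) with find (∈-concatMap⁻ g {xs = xs} z∈)
  ... | y , y∈ , z∈gy = All.lookup x∉ (∈-map⁺ key y∈) (g-disj (here refl) (there y∈) z∈gx z∈gy)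

⊆-length : {xs ys : List ℕ} → Unique xs → (∀ {x} → x ∈ xs → x ∈ ys) → length xs ≤ length ys
⊆-length {[]}     _          _     = z≤n
⊆-length {x ∷ xs} (x∉ ∷ xs!) xs⊆ys with ∈-∃++ (xs⊆ys (here refl))
... | as , bs , refl = subst (suc (length xs) ≤_) (sym (↭-length (shift x as bs))) (s≤s (⊆-length xs! xs⊆as++bs))
  where
  xs⊆as++bs : ∀ {z} → z ∈ xs → z ∈ as ++ bs
  xs⊆as++bs z∈ with ∈-resp-↭ (shift x as bs) (xs⊆ys (there z∈))
  ... | here z≡x = ⊥-elim (All.lookup x∉ z∈ (sym z≡x))
  ... | there z∈′ = z∈′

Unique-⊆-↭ : {xs ys : List ℕ} → Unique xs → Unique ys → (∀ {x} → x ∈ xs → x ∈ ys) →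
             length xs ≡ length ys → xs ↭ ys
Unique-⊆-↭ {xs} {ys} xs! ys! xs⊆ys |xs|≡|ys| = Unique-⇔-↭ xs! ys! xs⊆ys ys⊆xs
  where
  ys⊆xs : ∀ {y} → y ∈ ys → y ∈ xs
  ys⊆xs {y} y∈ with y ∈? xs
  ... | yes y∈xs = y∈xs
  ... | no  y∉xs = ⊥-elim (ℕP.<-irrefl |xs|≡|ys| (⊆-length (y≢xs ∷ xs!) y∷xs⊆ys))
    where
    y≢xs : All (y ≢_) xs
    y≢xs = All.tabulate (λ z∈ y≡z → y∉xs (subst (_∈ xs) (sym y≡z) z∈))
    y∷xs⊆ys : ∀ {z} → z ∈ y ∷ xs → z ∈ ys
    y∷xs⊆ys (here refl) = y∈
    y∷xs⊆ys (there z∈)  = xs⊆ys z∈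

notIn-sound : ∀ a as → notIn a as ≡ true → All (a ≢_) as
notIn-sound a []       _  = []
notIn-sound a (b ∷ bs) eq with a ≡ᵇ b in a≡ᵇb
... | false = (λ a≡b → case trans (sym (dec-true (a ≟ b) a≡b)) a≡ᵇb of λ ()) ∷ notIn-sound a bs eq

notIn-complete : ∀ a {as} → All (a ≢_) as → notIn a as ≡ true
notIn-complete a []                   = refl
notIn-complete a {b ∷ _} (a≢b ∷ a∉) rewrite dec-false (a ≟ b) a≢b = notIn-complete a a∉

distinct-sound : ∀ xs → distinct xs ≡ true → Unique xs
distinct-sound []       _  = []
distinct-sound (a ∷ as) eq with notIn a as in a∉
... | true = notIn-sound a as a∉ ∷ distinct-sound as eq

distinct-complete : ∀ {xs} → Unique xs → distinct xs ≡ true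
distinct-complete {[]}     []         = refl
distinct-complete {a ∷ as} (a∉ ∷ as!) rewrite notIn-complete a a∉ = distinct-complete as!

-- Arrangements of a list, enumerated by their last entry

picks : {A : Set} → List A → List (A × List A)
picks []       = []
picks (x ∷ xs) = (x , xs) ∷ map (Prod.map₂ (x ∷_)) (picks xs)

arrangements : {A : Set} → ℕ → List A → List (List A)
arrangements zero    R = [ [] ]
arrangements (suc k) R = concatMap (λ p → map (_∷ʳ proj₁ p) (arrangements k (proj₂ p))) (picks R)

permutations : {A : Set} → List A → List (List A)
permutations R = arrangements (length R) R

picks-↭ : {A : Set} (R : List A) {p : A × List A} → p ∈ picks R → R ↭ proj₁ p ∷ proj₂ p
picks-↭ (x ∷ xs) (here refl) = ↭-refl
picks-↭ (x ∷ xs) (there p∈) with ∈-map⁻ (Prod.map₂ (x ∷_)) p∈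
... | q , q∈ , refl = ↭-trans (↭.prep x (picks-↭ xs q∈)) (↭.swap x (proj₁ q) ↭-refl)

picks-length : {A : Set} (R : List A) {p : A × List A} → p ∈ picks R → length R ≡ suc (length (proj₂ p))
picks-length R p∈ = ↭-length (picks-↭ R p∈)

picks-length-pred : {A : Set} (R : List A) {n : ℕ} → length R ≡ suc n → {p : A × List A} → p ∈ picks R → length (proj₂ p) ≡ n
picks-length-pred R |R| p∈ = ℕP.suc-injective (trans (sym (picks-length R p∈)) |R|)

∈-picks : {A : Set} (R : List A) {x : A} → x ∈ R → ∃ λ R′ → (x , R′) ∈ picks R
∈-picks (y ∷ ys) (here refl) = ys , here refl
∈-picks (y ∷ ys) (there x∈) with ∈-picks ys x∈
... | R′ , p∈ = y ∷ R′ , there (∈-map⁺ (Prod.map₂ (y ∷_)) p∈)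

map-proj₁-picks : {A : Set} (R : List A) → map proj₁ (picks R) ≡ R
map-proj₁-picks []       = refl
map-proj₁-picks (x ∷ xs) = cong (x ∷_) (trans (sym (map-∘ (picks xs))) (map-proj₁-picks xs))

All-picks : {A : Set} {Q : A → Set} (R : List A) {p : A × List A} → All Q R → p ∈ picks R → All Q (proj₁ p ∷ proj₂ p)
All-picks R QR p∈ = All-resp-↭ (picks-↭ R p∈) QR

∈-arrangements⇒↭ : {A : Set} (k : ℕ) (R : List A) {σ : List A} → length R ≡ k → σ ∈ arrangements k R → σ ↭ R
∈-arrangements⇒↭ zero    []       refl (here refl) = ↭-refl
∈-arrangements⇒↭ (suc k) R {σ} |R| σ∈
  with find (∈-concatMap⁻ (λ p → map (_∷ʳ proj₁ p) (arrangements k (proj₂ p))) {xs = picks R} σ∈)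
... | p , p∈ , σ∈′ with ∈-map⁻ (_∷ʳ proj₁ p) σ∈′
... | τ , τ∈ , refl =
  ↭-trans (↭-sym (∷↭∷ʳ (proj₁ p) τ))
    (↭-trans (↭.prep (proj₁ p) (∈-arrangements⇒↭ k (proj₂ p) (picks-length-pred R |R| p∈) τ∈)) (↭-sym (picks-↭ R p∈)))

↭⇒∈-arrangements : {A : Set} (k : ℕ) (R σ : List A) → length R ≡ k → σ ↭ R → σ ∈ arrangements k R
↭⇒∈-arrangements zero    R []      |R| σ↭R = here refl
↭⇒∈-arrangements zero    R (x ∷ σ) |R| σ↭R with () ← trans (↭-length σ↭R) |R|
↭⇒∈-arrangements (suc k) R σ |R| σ↭R with initLast σ
... | [] with () ← trans (↭-length σ↭R) |R|
↭⇒∈-arrangements (suc k) R .(τ ∷ʳ x) |R| σ↭R | τ ∷ʳ′ x with ∈-picks R (∈-resp-↭ σ↭R (∈-++⁺ʳ τ (here refl)))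
... | R′ , p∈ =
  ∈-concatMap⁺ (λ p → map (_∷ʳ proj₁ p) (arrangements k (proj₂ p))) {xs = picks R}
    (lose p∈ (∈-map⁺ (_∷ʳ x) (↭⇒∈-arrangements k R′ τ (picks-length-pred R |R| p∈) τ↭R′)))
  where
  τ↭R′ : τ ↭ R′
  τ↭R′ = drop-∷ (↭-trans (∷↭∷ʳ x τ) (↭-trans σ↭R (picks-↭ R p∈)))

AllPairs-picks : {A : Set} {_~_ : A → A → Set} (R : List A) {p : A × List A} →
                 AllPairs _~_ R → p ∈ picks R → AllPairs _~_ (proj₂ p)
AllPairs-picks (x ∷ xs) (_   ∷ xs~) (here refl) = xs~
AllPairs-picks (x ∷ xs) (x~ ∷ xs~) (there p∈) with ∈-map⁻ (Prod.map₂ (x ∷_)) p∈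
... | q , q∈ , refl = All.tail (All-resp-↭ (picks-↭ xs q∈) x~) ∷ AllPairs-picks xs xs~ q∈

arrangements-unique : {A : Set} (k : ℕ) (R : List A) → length R ≡ k → Unique R → Unique (arrangements k R)
arrangements-unique zero    R _   _  = [] ∷ []
arrangements-unique (suc k) R |R| R! =
  Unique-concatMap proj₁ (λ p → map (_∷ʳ proj₁ p) (arrangements k (proj₂ p))) (picks R)
    (subst Unique (sym (map-proj₁-picks R)) R!)
    (λ {p} p∈ → Unique.map⁺ (λ {σ} {τ} → ∷ʳ-injectiveˡ σ τ)
                  (arrangements-unique k (proj₂ p) (picks-length-pred R |R| p∈) (AllPairs-picks R R! p∈)))
    lasts-equal
  where
  lasts-equal : ∀ {p q z} → p ∈ picks R → q ∈ picks R →
                z ∈ map (_∷ʳ proj₁ p) (arrangements k (proj₂ p)) → z ∈ map (_∷ʳ proj₁ q) (arrangements k (proj₂ q)) →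
                proj₁ p ≡ proj₁ q
  lasts-equal _ _ z∈ z∈′ with ∈-map⁻ (_∷ʳ _) z∈ | ∈-map⁻ (_∷ʳ _) z∈′
  ... | σ , _ , refl | τ , _ , z≡ = ∷ʳ-injectiveʳ σ τ z≡

words-unique : ∀ n k → Unique (words n k)
words-unique n zero    = [] ∷ []
words-unique n (suc k) =
  Unique-concatMap (λ w → w) (λ w → map (_∷ w) (applyUpTo suc n)) (words n k)
    (subst Unique (sym (map-id (words n k))) (words-unique n k))
    (λ _ → Unique.map⁺ (proj₁ ∘ ∷-injective) (Unique.applyUpTo⁺₁ suc n (λ i<j _ → ℕP.<⇒≢ i<j ∘ ℕP.suc-injective)))
    tails-equal
  where
  tails-equal : ∀ {w w′ z} → w ∈ words n k → w′ ∈ words n k →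
                z ∈ map (_∷ w) (applyUpTo suc n) → z ∈ map (_∷ w′) (applyUpTo suc n) → w ≡ w′
  tails-equal _ _ z∈ z∈′ with ∈-map⁻ (_∷ _) z∈ | ∈-map⁻ (_∷ _) z∈′
  ... | _ , _ , refl | _ , _ , z≡ = proj₂ (∷-injective z≡)

∈-words⁻ : ∀ n k {w} → w ∈ words n k → length w ≡ k × All (_∈ applyUpTo suc n) w
∈-words⁻ n zero    (here refl) = refl , []
∈-words⁻ n (suc k) w∈ with find (∈-concatMap⁻ (λ w → map (_∷ w) (applyUpTo suc n)) {xs = words n k} w∈)
... | w′ , w′∈ , w∈′ with ∈-map⁻ (_∷ w′) w∈′
... | a , a∈ , refl = cong suc (proj₁ (∈-words⁻ n k w′∈)) , a∈ ∷ proj₂ (∈-words⁻ n k w′∈)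

∈-words⁺ : ∀ n {w} → All (_∈ applyUpTo suc n) w → w ∈ words n (length w)
∈-words⁺ n []                = here refl
∈-words⁺ n {a ∷ w} (a∈ ∷ w⊆) =
  ∈-concatMap⁺ (λ w → map (_∷ w) (applyUpTo suc n)) {xs = words n (length w)} (lose (∈-words⁺ n w⊆) (∈-map⁺ (_∷ w) a∈))

∈-downFrom : ∀ n {x} → x ∈ applyDownFrom suc n → suc n > x
∈-downFrom (suc n) (here refl) = ℕP.n<1+n (suc n)
∈-downFrom (suc n) (there x∈)  = ℕP.m<n⇒m<1+n (∈-downFrom n x∈)

downFrom-decreasing : ∀ n → AllPairs _>_ (applyDownFrom suc n)
downFrom-decreasing zero    = []
downFrom-decreasing (suc n) = All.tabulate (∈-downFrom n) ∷ downFrom-decreasing n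

decreasing⇒Unique : ∀ {xs : List ℕ} → AllPairs _>_ xs → Unique xs
decreasing⇒Unique = AllPairs.map (λ x>y x≡y → ℕP.<-irrefl (sym x≡y) x>y)

upTo↭downFrom : ∀ n → applyUpTo suc n ↭ applyDownFrom suc n
upTo↭downFrom n = subst (applyUpTo suc n ↭_) (reverse-applyUpTo suc n) (↭-sym (↭-reverse (applyUpTo suc n)))

∈S⇒↭ : ∀ n {π} → π ∈ S n → π ↭ applyUpTo suc n
∈S⇒↭ n π∈ with ∈-filter⁻ (λ w → distinct w Bool.≟ true) {xs = words n n} π∈
... | π∈words , distinct-π with ∈-words⁻ n n π∈words
... | |π| , π⊆ = Unique-⊆-↭ (distinct-sound _ distinct-π) (Unique-resp-↭ (↭-sym (upTo↭downFrom n)) (decreasing⇒Unique (downFrom-decreasing n)))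
                    (All.lookup π⊆) (trans |π| (sym (length-applyUpTo suc n)))

↭⇒∈S : ∀ n {π} → π ↭ applyUpTo suc n → π ∈ S n
↭⇒∈S n {π} π↭ = ∈-filter⁺ (λ w → distinct w Bool.≟ true) {xs = words n n}
  (subst (λ k → π ∈ words n k) (trans (↭-length π↭) (length-applyUpTo suc n)) (∈-words⁺ n (All.tabulate (λ x∈ → ∈-resp-↭ π↭ x∈))))
  (distinct-complete (Unique-resp-↭ (↭-sym (↭-trans π↭ (upTo↭downFrom n))) (decreasing⇒Unique (downFrom-decreasing n))))

S↭permutations : ∀ n → S n ↭ permutations (applyDownFrom suc n)
S↭permutations n = Unique-⇔-↭
  (Unique.filter⁺ (λ w → distinct w Bool.≟ true) (words-unique n n))
  (arrangements-unique (length R) R refl R!)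
  (λ π∈ → ↭⇒∈-arrangements (length R) R _ refl (↭-trans (∈S⇒↭ n π∈) (upTo↭downFrom n)))
  (λ π∈ → ↭⇒∈S n (↭-trans (∈-arrangements⇒↭ (length R) R refl π∈) (↭-sym (upTo↭downFrom n))))
  where
  R = applyDownFrom suc n
  R! = decreasing⇒Unique (downFrom-decreasing n)

module Strategy (k₁ k₂ : ℕ) where

  accepts : ℕ → ℕ → Bool
  accepts i g = ((k₁ <ᵇ i) ∧ (g ≡ᵇ 0)) ∨ ((k₂ <ᵇ i) ∧ (g ≡ᵇ 1))

  acceptedAt : ℕ → ℕ → ℕ → Maybe ℕ
  acceptedAt i g y = if accepts i g then just y else nothing

  -- Unlike go, this does not accept the last entry by default.
  firstAccepted : ℕ → List ℕ → List ℕ → Maybe ℕ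
  firstAccepted i pre []       = nothing
  firstAccepted i pre (x ∷ xs) = if acceptHere k₁ k₂ i pre x then just x else firstAccepted (suc i) (x ∷ pre) xs

  go-∷ʳ : ∀ i pre σ x → go k₁ k₂ i pre (σ ∷ʳ x) ≡ fromMaybe x (firstAccepted i pre σ)
  go-∷ʳ i pre []          x = refl
  go-∷ʳ i pre (y ∷ [])    x = sym (if-float (fromMaybe x) (acceptHere k₁ k₂ i pre y))
  go-∷ʳ i pre (y ∷ z ∷ σ) x =
    trans (cong (if acceptHere k₁ k₂ i pre y then y else_) (go-∷ʳ (suc i) (y ∷ pre) (z ∷ σ) x))
          (sym (if-float (fromMaybe x) (acceptHere k₁ k₂ i pre y)))

  firstAccepted-∷ʳ : ∀ i pre σ y → firstAccepted i pre (σ ∷ʳ y) ≡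
    (firstAccepted i pre σ <∣> acceptedAt (i + length σ) (#greater y (σ ʳ++ pre)) y)
  firstAccepted-∷ʳ i pre []      y rewrite ℕP.+-identityʳ i = refl
  firstAccepted-∷ʳ i pre (z ∷ σ) y rewrite ℕP.+-suc i (length σ) =
    trans (cong (if acceptHere k₁ k₂ i pre z then just z else_) (firstAccepted-∷ʳ (suc i) (z ∷ pre) σ y))
          (sym (if-float (_<∣> acceptedAt (suc i + length σ) (#greater y (σ ʳ++ (z ∷ pre))) y) (acceptHere k₁ k₂ i pre z)))

-- Weighted counts of the outcomes, by removing the last entry

-- For arrangements of n distinct values, weighted by θ^inv: rejectAll n counts those in which
-- nothing is accepted, acceptMax n and acceptSecond n those in which the largest, resp. second
-- largest, value is accepted, and win n those in which the second largest is the final choice.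
module Recurrence (θ : ℚ) (k₁ k₂ : ℕ) where
  open Strategy k₁ k₂ using (accepts)

  Σθ : (ℕ → ℚ) → ℕ → ℚ
  Σθ φ zero    = 0ℚ
  Σθ φ (suc n) = φ 0 +ℚ θ * Σθ (φ ∘ suc) n

  Σθ-const : ∀ n c → Σθ (λ _ → c) n ≡ P θ n * c
  Σθ-const zero    c = sym (ℚP.*-zeroˡ c)
  Σθ-const (suc n) c rewrite Σθ-const n c | P-suc θ n =
    solve 3 (λ c t p → c :+ t :* (p :* c) := (con 1ℚ :+ t :* p) :* c) refl c θ (P θ n)

  rejectAll : ℕ → ℚ
  rejectAll zero    = 1ℚ
  rejectAll (suc n) = Σθ (λ g → rejectAll n * indicator (not (accepts (suc n) g))) (suc n)

  acceptMax : ℕ → ℚ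
  acceptMax zero    = 0ℚ
  acceptMax (suc n) = rejectAll n * indicator (accepts (suc n) 0) +ℚ θ * (P θ n * acceptMax n)

  acceptSecond : ℕ → ℚ
  acceptSecond zero          = 0ℚ
  acceptSecond (suc zero)    = 0ℚ
  acceptSecond (suc (suc n)) =
    acceptMax (suc n) +ℚ θ * (rejectAll (suc n) * indicator (accepts (suc (suc n)) 1) +ℚ θ * (P θ n * acceptSecond (suc n)))

  win : ℕ → ℚ
  win zero          = 0ℚ
  win (suc zero)    = 0ℚ
  win (suc (suc n)) = acceptMax (suc n) +ℚ θ * (rejectAll (suc n) +ℚ θ * (P θ n * acceptSecond (suc n)))

module Weights (θ : ℚ) (k₁ k₂ t : ℕ) where
  open Strategy k₁ k₂
  open Recurrence θ k₁ k₂

  weight : List ℕ → ℚ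
  weight σ = pow θ (inv σ)

  state : List ℕ → Maybe ℕ
  state = firstAccepted 1 []

  acceptedT : Maybe ℕ → ℚ
  acceptedT (just v) = indicator (v ≡ᵇ t)
  acceptedT nothing  = 0ℚ

  undecided : Maybe ℕ → ℚ
  undecided (just _) = 0ℚ
  undecided nothing  = 1ℚ

  weighted : (List ℕ → ℚ) → List ℕ → ℚ
  weighted V R = ∑ (permutations R) (λ π → weight π * V π)

  tAccepted noneAccepted tWins : List ℕ → ℚ
  tAccepted    = weighted (acceptedT ∘ state)
  noneAccepted = weighted (undecided ∘ state)
  tWins        = weighted (λ π → indicator (acceptedValue k₁ k₂ π ≡ᵇ t))

  rank : ℕ × List ℕ → ℕ
  rank p = #greater (proj₁ p) (proj₂ p)

  ∑picks : List ℕ → (ℕ × List ℕ → ℚ) → ℚ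
  ∑picks R f = ∑ (picks R) (λ p → pow θ (rank p) * f p)

  weight-∷ʳ : ∀ {σ R} x → σ ↭ R → weight (σ ∷ʳ x) ≡ weight σ * pow θ (#greater x R)
  weight-∷ʳ {σ} {R} x σ↭R = begin
    pow θ (inv (σ ∷ʳ x))             ≡⟨ cong (pow θ) (inv-∷ʳ σ x) ⟩
    pow θ (inv σ + #greater x σ)     ≡⟨ pow-+ θ (inv σ) _ ⟩
    weight σ * pow θ (#greater x σ)  ≡⟨ cong (λ g → weight σ * pow θ g) (#greater-↭ x σ↭R) ⟩
    weight σ * pow θ (#greater x R)  ∎
    where open ≡-Reasoning

  state-∷ʳ : ∀ {σ R} x → σ ↭ R → state (σ ∷ʳ x) ≡ (state σ <∣> acceptedAt (suc (length R)) (#greater x R) x)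
  state-∷ʳ {σ} x σ↭R =
    trans (firstAccepted-∷ʳ 1 [] σ x)
          (cong₂ (λ n g → state σ <∣> acceptedAt (suc n) g x) (↭-length σ↭R) (#greater-↭ x (↭-trans (↭-reverse σ) σ↭R)))

  weighted-∷ : ∀ v L (V : List ℕ → ℚ) (α β : ℕ × List ℕ → ℚ) →
    (∀ {p} → p ∈ picks (v ∷ L) → ∀ σ → σ ↭ proj₂ p →
       V (σ ∷ʳ proj₁ p) ≡ acceptedT (state σ) * α p +ℚ undecided (state σ) * β p) →
    weighted V (v ∷ L) ≡ ∑picks (v ∷ L) (λ p → tAccepted (proj₂ p) * α p +ℚ noneAccepted (proj₂ p) * β p)
  weighted-∷ v L V α β V-affine =
    trans (∑-concatMap (λ p → map (_∷ʳ proj₁ p) (arrangements (length L) (proj₂ p))) (picks (v ∷ L)) (λ π → weight π * V π))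
          (∑-cong (picks (v ∷ L)) by-last)
    where
    by-last : ∀ {p} → p ∈ picks (v ∷ L) →
      ∑ (map (_∷ʳ proj₁ p) (arrangements (length L) (proj₂ p))) (λ π → weight π * V π)
        ≡ pow θ (rank p) * (tAccepted (proj₂ p) * α p +ℚ noneAccepted (proj₂ p) * β p)
    by-last {p@(x , R)} p∈ rewrite ∑-map (_∷ʳ x) (arrangements (length L) R) (λ π → weight π * V π)
                                  | ℕP.suc-injective (picks-length (v ∷ L) p∈) = begin
      ∑ (permutations R) (λ σ → weight (σ ∷ʳ x) * V (σ ∷ʳ x))
        ≡⟨ ∑-cong (permutations R) (λ σ∈ → let σ↭R = ∈-arrangements⇒↭ (length R) R refl σ∈ in
                                            cong₂ _*_ (weight-∷ʳ x σ↭R) (V-affine p∈ _ σ↭R)) ⟩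
      ∑ (permutations R) (λ σ → weight σ * g * (acceptedT (state σ) * α p +ℚ undecided (state σ) * β p))
        ≡⟨ ∑-cong (permutations R) (λ {σ} _ → solve 6 (λ w g a α n β → w :* g :* (a :* α :+ n :* β) := g :* ((w :* a) :* α :+ (w :* n) :* β))
                                                       refl (weight σ) g (acceptedT (state σ)) (α p) (undecided (state σ)) (β p)) ⟩
      ∑ (permutations R) (λ σ → g * ((weight σ * acceptedT (state σ)) * α p +ℚ (weight σ * undecided (state σ)) * β p))
        ≡⟨ ∑-*ˡ (permutations R) g _ ⟩
      g * ∑ (permutations R) (λ σ → (weight σ * acceptedT (state σ)) * α p +ℚ (weight σ * undecided (state σ)) * β p)
        ≡⟨ cong (g *_) (∑-+ (permutations R) _ _) ⟩
      g * (∑ (permutations R) (λ σ → (weight σ * acceptedT (state σ)) * α p) +ℚ ∑ (permutations R) (λ σ → (weight σ * undecided (state σ)) * β p))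
        ≡⟨ cong (g *_) (cong₂ _+ℚ_ (∑-*ʳ (permutations R) (α p) _) (∑-*ʳ (permutations R) (β p) _)) ⟩
      g * (tAccepted R * α p +ℚ noneAccepted R * β p) ∎
      where
      open ≡-Reasoning
      g = pow θ (rank p)

  acceptedT-<∣> : ∀ s i g x → acceptedT (s <∣> acceptedAt i g x) ≡
    acceptedT s * 1ℚ +ℚ undecided s * (indicator (accepts i g) * indicator (x ≡ᵇ t))
  acceptedT-<∣> (just v) i g x =
    solve 2 (λ a c → a := a :* con 1ℚ :+ con 0ℚ :* c) refl (acceptedT (just v)) (indicator (accepts i g) * indicator (x ≡ᵇ t))
  acceptedT-<∣> nothing  i g x with accepts i g
  ... | true  = solve 1 (λ a → a := con 0ℚ :* con 1ℚ :+ con 1ℚ :* (con 1ℚ :* a)) refl (indicator (x ≡ᵇ t))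
  ... | false = solve 1 (λ a → con 0ℚ := con 0ℚ :* con 1ℚ :+ con 1ℚ :* (con 0ℚ :* a)) refl (indicator (x ≡ᵇ t))

  undecided-<∣> : ∀ s i g x → undecided (s <∣> acceptedAt i g x) ≡
    acceptedT s * 0ℚ +ℚ undecided s * indicator (not (accepts i g))
  undecided-<∣> (just v) i g x =
    solve 2 (λ a c → con 0ℚ := a :* con 0ℚ :+ con 0ℚ :* c) refl (acceptedT (just v)) (indicator (not (accepts i g)))
  undecided-<∣> nothing  i g x with accepts i g
  ... | true  = refl
  ... | false = refl

  fromMaybe-≡ᵇ : ∀ s x → indicator (fromMaybe x s ≡ᵇ t) ≡ acceptedT s * 1ℚ +ℚ undecided s * indicator (x ≡ᵇ t)
  fromMaybe-≡ᵇ (just v) x = solve 2 (λ a c → a := a :* con 1ℚ :+ con 0ℚ :* c) refl (acceptedT (just v)) (indicator (x ≡ᵇ t))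
  fromMaybe-≡ᵇ nothing  x = solve 1 (λ c → c := con 0ℚ :* con 1ℚ :+ con 1ℚ :* c) refl (indicator (x ≡ᵇ t))

  tAccepted-∷ : ∀ v L → tAccepted (v ∷ L) ≡
    ∑picks (v ∷ L) (λ p → tAccepted (proj₂ p) * 1ℚ
                           +ℚ noneAccepted (proj₂ p) * (indicator (accepts (suc (length L)) (rank p)) * indicator (proj₁ p ≡ᵇ t)))
  tAccepted-∷ v L = weighted-∷ v L (acceptedT ∘ state) _ _ step
    where
    step : ∀ {p} → p ∈ picks (v ∷ L) → ∀ σ → σ ↭ proj₂ p →
           acceptedT (state (σ ∷ʳ proj₁ p)) ≡
           acceptedT (state σ) * 1ℚ +ℚ undecided (state σ) * (indicator (accepts (suc (length L)) (rank p)) * indicator (proj₁ p ≡ᵇ t))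
    step {x , R} p∈ σ σ↭R rewrite state-∷ʳ x σ↭R | ℕP.suc-injective (picks-length (v ∷ L) p∈) =
      acceptedT-<∣> (state σ) (suc (length R)) (#greater x R) x

  noneAccepted-∷ : ∀ v L → noneAccepted (v ∷ L) ≡
    ∑picks (v ∷ L) (λ p → tAccepted (proj₂ p) * 0ℚ +ℚ noneAccepted (proj₂ p) * indicator (not (accepts (suc (length L)) (rank p))))
  noneAccepted-∷ v L = weighted-∷ v L (undecided ∘ state) _ _ step
    where
    step : ∀ {p} → p ∈ picks (v ∷ L) → ∀ σ → σ ↭ proj₂ p →
           undecided (state (σ ∷ʳ proj₁ p)) ≡
           acceptedT (state σ) * 0ℚ +ℚ undecided (state σ) * indicator (not (accepts (suc (length L)) (rank p)))
    step {x , R} p∈ σ σ↭R rewrite state-∷ʳ x σ↭R | ℕP.suc-injective (picks-length (v ∷ L) p∈) =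
      undecided-<∣> (state σ) (suc (length R)) (#greater x R) x

  tWins-∷ : ∀ v L → tWins (v ∷ L) ≡
    ∑picks (v ∷ L) (λ p → tAccepted (proj₂ p) * 1ℚ +ℚ noneAccepted (proj₂ p) * indicator (proj₁ p ≡ᵇ t))
  tWins-∷ v L = weighted-∷ v L _ _ _ (λ {p} _ σ _ →
    trans (cong (λ a → indicator (a ≡ᵇ t)) (go-∷ʳ 1 [] σ (proj₁ p))) (fromMaybe-≡ᵇ (state σ) (proj₁ p)))

  ∑picks-cong : ∀ R {f g} → (∀ {p} → p ∈ picks R → f p ≡ g p) → ∑picks R f ≡ ∑picks R g
  ∑picks-cong R f≡g = ∑-cong (picks R) (λ {p} p∈ → cong (pow θ (rank p) *_) (f≡g p∈))

  ∑picks-∷ : ∀ v L f → All (v >_) L →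
    ∑picks (v ∷ L) f ≡ f (v , L) +ℚ θ * ∑picks L (λ p → f (proj₁ p , v ∷ proj₂ p))
  ∑picks-∷ v L f v>L = cong₂ _+ℚ_ first rest
    where
    first : pow θ (#greater v L) * f (v , L) ≡ f (v , L)
    first rewrite #greater-of-max v v>L = ℚP.*-identityˡ _
    rest : ∑ (map (Prod.map₂ (v ∷_)) (picks L)) (λ p → pow θ (rank p) * f p) ≡
           θ * ∑picks L (λ p → f (proj₁ p , v ∷ proj₂ p))
    rest = trans (∑-map _ (picks L) _) (trans (∑-cong (picks L) one-more-greater) (∑-*ˡ (picks L) θ _))
      where
      one-more-greater : ∀ {p} → p ∈ picks L → pow θ (#greater (proj₁ p) (v ∷ proj₂ p)) * f (proj₁ p , v ∷ proj₂ p)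
                                              ≡ θ * (pow θ (rank p) * f (proj₁ p , v ∷ proj₂ p))
      one-more-greater {x , R} p∈ with All-picks L v>L p∈
      ... | v>x ∷ _ rewrite #greater-∷-larger x v R v>x = ℚP.*-assoc θ _ _

  ∑picks-rank : ∀ R φ → AllPairs _>_ R → ∑picks R (φ ∘ rank) ≡ Σθ φ (length R)
  ∑picks-rank []      φ []           = refl
  ∑picks-rank (v ∷ L) φ (v>L ∷ L↓) = begin
    ∑picks (v ∷ L) (φ ∘ rank)               ≡⟨ ∑picks-∷ v L _ v>L ⟩
    φ (#greater v L) +ℚ θ * ∑picks L (λ p → φ (#greater (proj₁ p) (v ∷ proj₂ p)))
      ≡⟨ cong₂ (λ g s → φ g +ℚ θ * s) (#greater-of-max v v>L) (∑picks-cong L one-more-greater) ⟩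
    φ 0 +ℚ θ * ∑picks L ((φ ∘ suc) ∘ rank)  ≡⟨ cong (λ s → φ 0 +ℚ θ * s) (∑picks-rank L (φ ∘ suc) L↓) ⟩
    Σθ φ (suc (length L))                   ∎
    where
    open ≡-Reasoning
    one-more-greater : ∀ {p} → p ∈ picks L → φ (#greater (proj₁ p) (v ∷ proj₂ p)) ≡ φ (suc (rank p))
    one-more-greater {x , R} p∈ with All-picks L v>L p∈
    ... | v>x ∷ _ = cong φ (#greater-∷-larger x v R v>x)

  noneAccepted-decreasing : ∀ n R → length R ≡ n → AllPairs _>_ R → noneAccepted R ≡ rejectAll n
  noneAccepted-decreasing zero    []      refl []  = refl
  noneAccepted-decreasing (suc n) (v ∷ L) |R| R↓ = begin
    noneAccepted (v ∷ L)       ≡⟨ noneAccepted-∷ v L ⟩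
    ∑picks (v ∷ L) _           ≡⟨ ∑picks-cong (v ∷ L) by-rank ⟩
    ∑picks (v ∷ L) (φ ∘ rank)  ≡⟨ ∑picks-rank (v ∷ L) φ R↓ ⟩
    Σθ φ (suc (length L))      ≡⟨ cong (λ m → rejectAll (suc m)) |L| ⟩
    rejectAll (suc n)          ∎
    where
    open ≡-Reasoning
    |L| = ℕP.suc-injective |R|
    φ : ℕ → ℚ
    φ g = rejectAll (length L) * indicator (not (accepts (suc (length L)) g))
    by-rank : ∀ {p} → p ∈ picks (v ∷ L) →
      tAccepted (proj₂ p) * 0ℚ +ℚ noneAccepted (proj₂ p) * indicator (not (accepts (suc (length L)) (rank p))) ≡ φ (rank p)
    by-rank {p} p∈ rewrite noneAccepted-decreasing n (proj₂ p) (picks-length-pred (v ∷ L) |R| p∈) (AllPairs-picks (v ∷ L) R↓ p∈)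
                         | |L| =
      solve 3 (λ a r c → a :* con 0ℚ :+ r :* c := r :* c) refl (tAccepted (proj₂ p)) (rejectAll n) (indicator (not (accepts (suc n) (rank p))))

  tAccepted-absent : ∀ n R → length R ≡ n → t ∉ R → tAccepted R ≡ 0ℚ
  tAccepted-absent zero    []      refl t∉ = refl
  tAccepted-absent (suc n) (v ∷ L) |R| t∉ = begin
    tAccepted (v ∷ L)             ≡⟨ tAccepted-∷ v L ⟩
    ∑picks (v ∷ L) _              ≡⟨ ∑picks-cong (v ∷ L) vanishes ⟩
    ∑picks (v ∷ L) (λ _ → 0ℚ)     ≡⟨ ∑-cong (picks (v ∷ L)) (λ {p} _ → ℚP.*-zeroʳ (pow θ (rank p))) ⟩
    ∑ (picks (v ∷ L)) (λ _ → 0ℚ)  ≡⟨ ∑-zero (picks (v ∷ L)) ⟩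
    0ℚ                            ∎
    where
    open ≡-Reasoning
    vanishes : ∀ {p} → p ∈ picks (v ∷ L) →
      tAccepted (proj₂ p) * 1ℚ +ℚ noneAccepted (proj₂ p) * (indicator (accepts (suc (length L)) (rank p)) * indicator (proj₁ p ≡ᵇ t)) ≡ 0ℚ
    vanishes {x , R} p∈ with All-picks (v ∷ L) (All.tabulate (λ {z} z∈ z≡t → t∉ (subst (_∈ v ∷ L) z≡t z∈))) p∈
    ... | x≢t ∷ R∌t rewrite tAccepted-absent n R (picks-length-pred (v ∷ L) |R| p∈) (λ t∈ → All.lookup R∌t t∈ refl)
                          | dec-false (x ≟ t) x≢t =
      solve 2 (λ z c → con 0ℚ :* con 1ℚ :+ z :* (c :* con 0ℚ) := con 0ℚ) refl (noneAccepted R) (indicator (accepts (suc (length L)) (#greater x R)))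

  private
    max-∉ : ∀ {y L} → All (y >_) L → y ∉ L
    max-∉ y>L y∈ = ℕP.<-irrefl refl (All.lookup y>L y∈)

    dropped : ∀ a z c → a * 1ℚ +ℚ z * (c * 0ℚ) ≡ a
    dropped = solve 3 (λ a z c → a :* con 1ℚ :+ z :* (c :* con 0ℚ) := a) refl

    kept : ∀ z c → 0ℚ * 1ℚ +ℚ z * (c * 1ℚ) ≡ z * c
    kept = solve 2 (λ z c → con 0ℚ :* con 1ℚ :+ z :* (c :* con 1ℚ) := z :* c) refl

  tAccepted-max-∷ : ∀ L → AllPairs _>_ (t ∷ L) →
    (∀ {p} → p ∈ picks L → tAccepted (t ∷ proj₂ p) ≡ acceptMax (length L)) →
    tAccepted (t ∷ L) ≡ acceptMax (suc (length L))
  tAccepted-max-∷ L (t>L ∷ L↓) earlier = begin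
    tAccepted (t ∷ L)                                            ≡⟨ tAccepted-∷ t L ⟩
    ∑picks (t ∷ L) f                                             ≡⟨ ∑picks-∷ t L f t>L ⟩
    f (t , L) +ℚ θ * ∑picks L (λ p → f (proj₁ p , t ∷ proj₂ p))  ≡⟨ cong₂ (λ a s → a +ℚ θ * s) t-last (∑picks-cong L t-earlier) ⟩
    rejectAll n * indicator (accepts (suc n) 0) +ℚ θ * ∑picks L (λ _ → acceptMax n)
      ≡⟨ cong (λ s → rejectAll n * indicator (accepts (suc n) 0) +ℚ θ * s)
              (trans (∑picks-rank L (λ _ → acceptMax n) L↓) (Σθ-const n (acceptMax n))) ⟩
    acceptMax (suc n)                                            ∎
    where
    open ≡-Reasoning
    n = length L
    f : ℕ × List ℕ → ℚ
    f p = tAccepted (proj₂ p) * 1ℚ +ℚ noneAccepted (proj₂ p) * (indicator (accepts (suc n) (rank p)) * indicator (proj₁ p ≡ᵇ t))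
    t-last : f (t , L) ≡ rejectAll n * indicator (accepts (suc n) 0)
    t-last rewrite tAccepted-absent n L refl (max-∉ t>L) | noneAccepted-decreasing n L refl L↓
                 | #greater-of-max t t>L | dec-true (t ≟ t) refl = kept (rejectAll n) _
    t-earlier : ∀ {p} → p ∈ picks L → f (proj₁ p , t ∷ proj₂ p) ≡ acceptMax n
    t-earlier {x , R} p∈ with All-picks L t>L p∈
    ... | t>x ∷ _ rewrite earlier p∈ | dec-false (x ≟ t) (ℕP.<⇒≢ t>x) =
      dropped (acceptMax n) (noneAccepted (t ∷ R)) (indicator (accepts (suc n) (#greater x (t ∷ R))))

  tAccepted-max : ∀ n L → length L ≡ n → AllPairs _>_ (t ∷ L) → tAccepted (t ∷ L) ≡ acceptMax (suc n)
  tAccepted-max zero    []  refl t∷L↓              = tAccepted-max-∷ [] t∷L↓ (λ ())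
  tAccepted-max (suc n) L   |L|  t∷L↓@(t>L ∷ L↓) = trans (tAccepted-max-∷ L t∷L↓ earlier) (cong (acceptMax ∘ suc) |L|)
    where
    earlier : ∀ {p} → p ∈ picks L → tAccepted (t ∷ proj₂ p) ≡ acceptMax (length L)
    earlier {x , R} p∈ with All-picks L t>L p∈
    ... | _ ∷ t>R = trans (tAccepted-max n R (picks-length-pred L |L| p∈) (t>R ∷ AllPairs-picks L L↓ p∈))
                          (cong acceptMax (sym |L|))

  tAccepted-second-∷ : ∀ u L → AllPairs _>_ (u ∷ t ∷ L) →
    (∀ {p} → p ∈ picks L → tAccepted (u ∷ t ∷ proj₂ p) ≡ acceptSecond (suc (length L))) →
    tAccepted (u ∷ t ∷ L) ≡ acceptSecond (suc (suc (length L)))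
  tAccepted-second-∷ u L ((u>t ∷ u>L) ∷ t>L ∷ L↓) earlier = begin
    tAccepted (u ∷ t ∷ L)                                 ≡⟨ tAccepted-∷ u (t ∷ L) ⟩
    ∑picks (u ∷ t ∷ L) f                                  ≡⟨ ∑picks-∷ u (t ∷ L) f (u>t ∷ u>L) ⟩
    f (u , t ∷ L) +ℚ θ * ∑picks (t ∷ L) f₁                ≡⟨ cong (λ s → f (u , t ∷ L) +ℚ θ * s) (∑picks-∷ t L f₁ t>L) ⟩
    f (u , t ∷ L) +ℚ θ * (f₁ (t , L) +ℚ θ * ∑picks L f₂)  ≡⟨ cong₂ (λ a s → a +ℚ θ * s) u-last (cong₂ (λ b s → b +ℚ θ * s) t-last t-earlier) ⟩
    acceptSecond (suc (suc n))                            ∎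
    where
    open ≡-Reasoning
    n = length L
    f f₁ f₂ : ℕ × List ℕ → ℚ
    f p  = tAccepted (proj₂ p) * 1ℚ +ℚ noneAccepted (proj₂ p) * (indicator (accepts (suc (suc n)) (rank p)) * indicator (proj₁ p ≡ᵇ t))
    f₁ p = f (proj₁ p , u ∷ proj₂ p)
    f₂ p = f₁ (proj₁ p , t ∷ proj₂ p)
    u-last : f (u , t ∷ L) ≡ acceptMax (suc n)
    u-last rewrite tAccepted-max n L refl (t>L ∷ L↓) | dec-false (u ≟ t) (ℕP.<⇒≢ u>t ∘ sym) =
      dropped (acceptMax (suc n)) (noneAccepted (t ∷ L)) (indicator (accepts (suc (suc n)) (#greater u (t ∷ L))))
    t-last : f₁ (t , L) ≡ rejectAll (suc n) * indicator (accepts (suc (suc n)) 1)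
    t-last rewrite tAccepted-absent (suc n) (u ∷ L) refl (λ { (here t≡u) → ℕP.<-irrefl t≡u u>t ; (there t∈) → max-∉ t>L t∈ })
                 | noneAccepted-decreasing (suc n) (u ∷ L) refl (u>L ∷ L↓)
                 | #greater-∷-larger t u L u>t | #greater-of-max t t>L | dec-true (t ≟ t) refl = kept (rejectAll (suc n)) _
    t-earlier : ∑picks L f₂ ≡ P θ n * acceptSecond (suc n)
    t-earlier = trans (∑picks-cong L {g = λ _ → acceptSecond (suc n)} below-t)
                      (trans (∑picks-rank L (λ _ → acceptSecond (suc n)) L↓) (Σθ-const n (acceptSecond (suc n))))
      where
      below-t : ∀ {p} → p ∈ picks L → f₂ p ≡ acceptSecond (suc n)
      below-t {x , R} p∈ with All-picks L t>L p∈
      ... | t>x ∷ _ rewrite earlier p∈ | dec-false (x ≟ t) (ℕP.<⇒≢ t>x) =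
        dropped (acceptSecond (suc n)) (noneAccepted (u ∷ t ∷ R)) (indicator (accepts (suc (suc n)) (#greater x (u ∷ t ∷ R))))

  tAccepted-second : ∀ n u L → length L ≡ n → AllPairs _>_ (u ∷ t ∷ L) → tAccepted (u ∷ t ∷ L) ≡ acceptSecond (suc (suc n))
  tAccepted-second zero    u [] refl u∷t∷L↓ = tAccepted-second-∷ u [] u∷t∷L↓ (λ ())
  tAccepted-second (suc n) u L  |L|  u∷t∷L↓@((u>t ∷ u>L) ∷ t>L ∷ L↓) =
    trans (tAccepted-second-∷ u L u∷t∷L↓ earlier) (cong (acceptSecond ∘ suc ∘ suc) |L|)
    where
    earlier : ∀ {p} → p ∈ picks L → tAccepted (u ∷ t ∷ proj₂ p) ≡ acceptSecond (suc (length L))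
    earlier {x , R} p∈ with All-picks L u>L p∈ | All-picks L t>L p∈
    ... | _ ∷ u>R | _ ∷ t>R =
      trans (tAccepted-second n u R (picks-length-pred L |L| p∈) ((u>t ∷ u>R) ∷ t>R ∷ AllPairs-picks L L↓ p∈))
            (cong (acceptSecond ∘ suc) (sym |L|))

  tWins-second : ∀ u L → AllPairs _>_ (u ∷ t ∷ L) → tWins (u ∷ t ∷ L) ≡ win (suc (suc (length L)))
  tWins-second u L ((u>t ∷ u>L) ∷ t>L ∷ L↓) = begin
    tWins (u ∷ t ∷ L)                                     ≡⟨ tWins-∷ u (t ∷ L) ⟩
    ∑picks (u ∷ t ∷ L) f                                  ≡⟨ ∑picks-∷ u (t ∷ L) f (u>t ∷ u>L) ⟩
    f (u , t ∷ L) +ℚ θ * ∑picks (t ∷ L) f₁                ≡⟨ cong (λ s → f (u , t ∷ L) +ℚ θ * s) (∑picks-∷ t L f₁ t>L) ⟩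
    f (u , t ∷ L) +ℚ θ * (f₁ (t , L) +ℚ θ * ∑picks L f₂)  ≡⟨ cong₂ (λ a s → a +ℚ θ * s) u-last (cong₂ (λ b s → b +ℚ θ * s) t-last t-earlier) ⟩
    win (suc (suc n))                                     ∎
    where
    open ≡-Reasoning
    n = length L
    f f₁ f₂ : ℕ × List ℕ → ℚ
    f p  = tAccepted (proj₂ p) * 1ℚ +ℚ noneAccepted (proj₂ p) * indicator (proj₁ p ≡ᵇ t)
    f₁ p = f (proj₁ p , u ∷ proj₂ p)
    f₂ p = f₁ (proj₁ p , t ∷ proj₂ p)
    u-last : f (u , t ∷ L) ≡ acceptMax (suc n)
    u-last rewrite tAccepted-max n L refl (t>L ∷ L↓) | dec-false (u ≟ t) (ℕP.<⇒≢ u>t ∘ sym) =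
      solve 2 (λ a z → a :* con 1ℚ :+ z :* con 0ℚ := a) refl (acceptMax (suc n)) (noneAccepted (t ∷ L))
    t-last : f₁ (t , L) ≡ rejectAll (suc n)
    t-last rewrite tAccepted-absent (suc n) (u ∷ L) refl (λ { (here t≡u) → ℕP.<-irrefl t≡u u>t ; (there t∈) → max-∉ t>L t∈ })
                 | noneAccepted-decreasing (suc n) (u ∷ L) refl (u>L ∷ L↓) | dec-true (t ≟ t) refl =
      solve 1 (λ z → con 0ℚ :* con 1ℚ :+ z :* con 1ℚ := z) refl (rejectAll (suc n))
    t-earlier : ∑picks L f₂ ≡ P θ n * acceptSecond (suc n)
    t-earlier = trans (∑picks-cong L {g = λ _ → acceptSecond (suc n)} below-t)
                      (trans (∑picks-rank L (λ _ → acceptSecond (suc n)) L↓) (Σθ-const n (acceptSecond (suc n))))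
      where
      below-t : ∀ {p} → p ∈ picks L → f₂ p ≡ acceptSecond (suc n)
      below-t {x , R} p∈ with All-picks L t>L p∈
      ... | t>x ∷ t>R rewrite dec-false (x ≟ t) (ℕP.<⇒≢ t>x) = begin
        tAccepted (u ∷ t ∷ R) * 1ℚ +ℚ noneAccepted (u ∷ t ∷ R) * 0ℚ
          ≡⟨ solve 2 (λ a z → a :* con 1ℚ :+ z :* con 0ℚ := a) refl (tAccepted (u ∷ t ∷ R)) (noneAccepted (u ∷ t ∷ R)) ⟩
        tAccepted (u ∷ t ∷ R)
          ≡⟨ tAccepted-second (length R) u R refl ((u>t ∷ All.tail (All-picks L u>L p∈)) ∷ t>R ∷ AllPairs-picks L L↓ p∈) ⟩
        acceptSecond (suc (suc (length R)))
          ≡⟨ cong (acceptSecond ∘ suc) (picks-length L p∈) ⟨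
        acceptSecond (suc n) ∎

W₁≡win : ∀ θ k₁ k₂ n → W₁ θ (suc (suc n)) k₁ k₂ ≡ Recurrence.win θ k₁ k₂ (suc (suc n))
W₁≡win θ k₁ k₂ n = begin
  W₁ θ N k₁ k₂                                               ≡⟨ ∑-filter (winnable N k₁ k₂) weight (S N) ⟩
  ∑ (S N) (λ π → weight π * indicator (winnable N k₁ k₂ π))  ≡⟨ ∑-↭ _ (S↭permutations N) ⟩
  tWins (applyDownFrom suc N)                                ≡⟨ tWins-second N (applyDownFrom suc n) (downFrom-decreasing N) ⟩
  win (suc (suc (length (applyDownFrom suc n))))             ≡⟨ cong (win ∘ suc ∘ suc) (length-applyDownFrom suc n) ⟩
  win N                                                      ∎
  where
  open ≡-Reasoning
  open Weights θ k₁ k₂ (suc n)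
  open Recurrence θ k₁ k₂ using (win)
  N = suc (suc n)

-- The recurrences in the regimes n ≤ k₁, k₁ < n ≤ k₂ and k₂ < n

module Regimes (θ : ℚ) (k₁ k₂ : ℕ) where
  open Recurrence θ k₁ k₂

  private
    not-below : ∀ {k n} → n ≤ k → (k <ᵇ n) ≡ false
    not-below {k} {n} n≤k = dec-false (k <? n) (ℕP.≤⇒≯ n≤k)

    below : ∀ {k n} → n > k → (k <ᵇ n) ≡ true
    below {k} {n} k<n = dec-true (k <? n) k<n

  rejectAll-early-step : ∀ m → suc m ≤ k₁ → suc m ≤ k₂ → rejectAll (suc m) ≡ P θ (suc m) * rejectAll m
  rejectAll-early-step m h₁ h₂ rewrite not-below h₁ | not-below h₂ =
    trans (Σθ-const (suc m) (rejectAll m * 1ℚ)) (cong (P θ (suc m) *_) (ℚP.*-identityʳ _))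

  rejectAll-middle-step : ∀ m → suc m > k₁ → suc m ≤ k₂ → rejectAll (suc m) ≡ θ * P θ m * rejectAll m
  rejectAll-middle-step m h₁ h₂ rewrite below h₁ | not-below h₂ | Σθ-const m (rejectAll m * 1ℚ) =
    solve 3 (λ z t p → z :* con 0ℚ :+ t :* (p :* (z :* con 1ℚ)) := t :* p :* z) refl (rejectAll m) θ (P θ m)

  rejectAll-late-step : ∀ m → suc (suc m) > k₁ → suc (suc m) > k₂ → rejectAll (suc (suc m)) ≡ θ * θ * P θ m * rejectAll (suc m)
  rejectAll-late-step m h₁ h₂ rewrite below h₁ | below h₂ | Σθ-const m (rejectAll (suc m) * 1ℚ) =
    solve 3 (λ z t p → z :* con 0ℚ :+ t :* (z :* con 0ℚ :+ t :* (p :* (z :* con 1ℚ))) := t :* t :* p :* z) refl (rejectAll (suc m)) θ (P θ m)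

  acceptMax-early-step : ∀ m → suc m ≤ k₁ → suc m ≤ k₂ → acceptMax (suc m) ≡ θ * (P θ m * acceptMax m)
  acceptMax-early-step m h₁ h₂ rewrite not-below h₁ | not-below h₂ =
    solve 2 (λ z w → z :* con 0ℚ :+ w := w) refl (rejectAll m) (θ * (P θ m * acceptMax m))

  acceptMax-step : ∀ m → suc m > k₁ → acceptMax (suc m) ≡ rejectAll m +ℚ θ * (P θ m * acceptMax m)
  acceptMax-step m h₁ rewrite below h₁ = cong (_+ℚ θ * (P θ m * acceptMax m)) (ℚP.*-identityʳ (rejectAll m))

  acceptSecond-step : ∀ m → suc (suc m) ≤ k₂ →
    acceptSecond (suc (suc m)) ≡ acceptMax (suc m) +ℚ θ * (θ * (P θ m * acceptSecond (suc m)))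
  acceptSecond-step m h₂ rewrite not-below h₂ | ∧-zeroʳ (k₁ <ᵇ suc (suc m)) =
    cong (λ w → acceptMax (suc m) +ℚ θ * w)
         (solve 3 (λ z t w → z :* con 0ℚ :+ t :* w := t :* w) refl (rejectAll (suc m)) θ (P θ m * acceptSecond (suc m)))

  win-late-step : ∀ m → suc (suc m) > k₂ → win (suc (suc m)) ≡ acceptSecond (suc (suc m))
  win-late-step m h₂ rewrite below h₂ | ∨-zeroʳ ((k₁ <ᵇ suc (suc m)) ∧ false) =
    cong (λ z → acceptMax (suc m) +ℚ θ * (z +ℚ θ * (P θ m * acceptSecond (suc m)))) (sym (ℚP.*-identityʳ (rejectAll (suc m))))

-- Closed forms, for k₁ = 1 + q and k₂ = k₁ + a

module ClosedForms (θ : ℚ) (θ>0 : 0ℚ < θ) (q a : ℕ) where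

  k₁ k₂ : ℕ
  k₁ = suc q
  k₂ = suc (q + a)

  open Recurrence θ k₁ k₂
  open Regimes θ k₁ k₂
  open Positivity θ θ>0

  P⁻¹ : ℕ → ℚ
  P⁻¹ n = recip (P θ n)

  recipSum ratioSum crossSum : ℕ → ℚ
  recipSum b = Σ< b (λ j → P⁻¹ (k₁ + j))
  ratioSum b = Σ< b (λ j → P θ (b ∸ j) * P⁻¹ (k₁ + j))
  crossSum e = Σ< e (λ j → pow θ (suc j) * P⁻¹ (suc (k₂ + j)) * P⁻¹ (k₂ + j))

  private
    k₁≤k₂ : k₁ ≤ k₂
    k₁≤k₂ = s≤s (ℕP.m≤m+n q a)

    k₁<1+k₁+ : ∀ b → suc (k₁ + b) > k₁
    k₁<1+k₁+ b = s≤s (s≤s (ℕP.m≤m+n q b))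

    k₂<2+k₂+ : ∀ e → suc (suc (k₂ + e)) > k₂
    k₂<2+k₂+ e = s≤s (s≤s (ℕP.m≤n⇒m≤1+n (ℕP.m≤m+n (q + a) e)))

    k₁<2+k₂+ : ∀ e → suc (suc (k₂ + e)) > k₁
    k₁<2+k₂+ e = ℕP.≤-<-trans k₁≤k₂ (k₂<2+k₂+ e)

    1+k₁+≤k₂ : ∀ {b} → suc b ≤ a → suc (k₁ + b) ≤ k₂
    1+k₁+≤k₂ {b} b<a = s≤s (subst (ℕ._≤ q + a) (ℕP.+-suc q b) (ℕP.+-monoʳ-≤ q b<a))

  rejectAll-early : ∀ m → m ≤ k₁ → rejectAll m ≡ P! θ m
  rejectAll-early zero    _   = refl
  rejectAll-early (suc m) m<k₁ =
    trans (rejectAll-early-step m m<k₁ (ℕP.≤-trans m<k₁ k₁≤k₂))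
          (cong (P θ (suc m) *_) (rejectAll-early m (ℕP.≤-trans (ℕP.n≤1+n m) m<k₁)))

  rejectAll-middle : ∀ b → b ≤ a → rejectAll (k₁ + b) ≡ pow θ b * P θ k₁ * P! θ (q + b)
  rejectAll-middle zero    _   rewrite ℕP.+-identityʳ q =
    trans (rejectAll-early k₁ ℕP.≤-refl) (cong (_* P! θ q) (sym (ℚP.*-identityˡ (P θ k₁))))
  rejectAll-middle (suc b) b<a = begin
    rejectAll (k₁ + suc b)                     ≡⟨ cong (rejectAll ∘ suc) (ℕP.+-suc q b) ⟩
    rejectAll (suc (k₁ + b))                   ≡⟨ rejectAll-middle-step (k₁ + b) (k₁<1+k₁+ b) (1+k₁+≤k₂ b<a) ⟩
    θ * P θ (k₁ + b) * rejectAll (k₁ + b)      ≡⟨ cong (θ * P θ (k₁ + b) *_) (rejectAll-middle b (ℕP.<⇒≤ b<a)) ⟩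
    θ * P θ (k₁ + b) * (pow θ b * P θ k₁ * P! θ (q + b))
      ≡⟨ solve 5 (λ t p e k f → t :* p :* (e :* k :* f) := t :* e :* k :* (p :* f)) refl θ (P θ (k₁ + b)) (pow θ b) (P θ k₁) (P! θ (q + b)) ⟩
    pow θ (suc b) * P θ k₁ * P! θ (k₁ + b)     ≡⟨ cong (λ n → pow θ (suc b) * P θ k₁ * P! θ n) (ℕP.+-suc q b) ⟨
    pow θ (suc b) * P θ k₁ * P! θ (q + suc b)  ∎
    where open ≡-Reasoning

  rejectAll-late : ∀ e → rejectAll (suc (k₂ + e)) ≡ pow θ a * pow θ (suc e) * pow θ (suc e) * P θ k₁ * P θ (q + a) * P! θ (q + a + e)
  rejectAll-late zero rewrite ℕP.+-identityʳ (q + a) = begin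
    rejectAll (suc k₂)                                                 ≡⟨ rejectAll-late-step (q + a) (k₁<1+k₁+ a) ℕP.≤-refl ⟩
    θ * θ * P θ (q + a) * rejectAll k₂                                 ≡⟨ cong (θ * θ * P θ (q + a) *_) (rejectAll-middle a ℕP.≤-refl) ⟩
    θ * θ * P θ (q + a) * (pow θ a * P θ k₁ * P! θ (q + a))
      ≡⟨ solve 5 (λ t p e k f → t :* t :* p :* (e :* k :* f) := e :* (t :* con 1ℚ) :* (t :* con 1ℚ) :* k :* p :* f) refl
               θ (P θ (q + a)) (pow θ a) (P θ k₁) (P! θ (q + a)) ⟩
    pow θ a * pow θ 1 * pow θ 1 * P θ k₁ * P θ (q + a) * P! θ (q + a)  ∎
    where open ≡-Reasoning
  rejectAll-late (suc e) = begin
    rejectAll (suc (k₂ + suc e))                     ≡⟨ cong (rejectAll ∘ suc ∘ suc) (ℕP.+-suc (q + a) e) ⟩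
    rejectAll (suc (suc (k₂ + e)))                   ≡⟨ rejectAll-late-step (k₂ + e) (k₁<2+k₂+ e) (k₂<2+k₂+ e) ⟩
    θ * θ * P θ (k₂ + e) * rejectAll (suc (k₂ + e))  ≡⟨ cong (θ * θ * P θ (k₂ + e) *_) (rejectAll-late e) ⟩
    θ * θ * P θ (k₂ + e) * (pow θ a * pow θ (suc e) * pow θ (suc e) * P θ k₁ * P θ (q + a) * P! θ (q + a + e))
      ≡⟨ solve 7 (λ t p ea ee k pa f → t :* t :* p :* (ea :* (t :* ee) :* (t :* ee) :* k :* pa :* f)
                                      := ea :* (t :* (t :* ee)) :* (t :* (t :* ee)) :* k :* pa :* (p :* f)) refl
               θ (P θ (k₂ + e)) (pow θ a) (pow θ e) (P θ k₁) (P θ (q + a)) (P! θ (q + a + e)) ⟩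
    pow θ a * pow θ (2 + e) * pow θ (2 + e) * P θ k₁ * P θ (q + a) * P! θ (k₂ + e)
      ≡⟨ cong (λ n → pow θ a * pow θ (2 + e) * pow θ (2 + e) * P θ k₁ * P θ (q + a) * P! θ n) (ℕP.+-suc (q + a) e) ⟨
    pow θ a * pow θ (2 + e) * pow θ (2 + e) * P θ k₁ * P θ (q + a) * P! θ (q + a + suc e) ∎
    where open ≡-Reasoning

  acceptMax-early : ∀ m → m ≤ k₁ → acceptMax m ≡ 0ℚ
  acceptMax-early zero    _    = refl
  acceptMax-early (suc m) m<k₁ = begin
    acceptMax (suc m)          ≡⟨ acceptMax-early-step m m<k₁ (ℕP.≤-trans m<k₁ k₁≤k₂) ⟩
    θ * (P θ m * acceptMax m)  ≡⟨ cong (λ h → θ * (P θ m * h)) (acceptMax-early m (ℕP.≤-trans (ℕP.n≤1+n m) m<k₁)) ⟩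
    θ * (P θ m * 0ℚ)           ≡⟨ solve 2 (λ t p → t :* (p :* con 0ℚ) := con 0ℚ) refl θ (P θ m) ⟩
    0ℚ                         ∎
    where open ≡-Reasoning

  -- Multiplying by θ makes these closed forms uniform: they start with a factor θ^(b-1).
  acceptMax-middle : ∀ b → b ≤ suc a → θ * acceptMax (k₁ + b) ≡ pow θ b * P θ k₁ * P! θ (q + b) * recipSum b
  acceptMax-middle zero    _ rewrite ℕP.+-identityʳ q | acceptMax-early k₁ ℕP.≤-refl =
    solve 3 (λ t k f → t :* con 0ℚ := con 1ℚ :* k :* f :* con 0ℚ) refl θ (P θ k₁) (P! θ q)
  acceptMax-middle (suc b) b≤a rewrite ℕP.+-suc q b = begin
    θ * acceptMax (suc (k₁ + b))
      ≡⟨ cong (θ *_) (acceptMax-step (k₁ + b) (k₁<1+k₁+ b)) ⟩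
    θ * (rejectAll (k₁ + b) +ℚ θ * (p * acceptMax (k₁ + b)))
      ≡⟨ solve 4 (λ t z p h → t :* (z :+ t :* (p :* h)) := t :* z :+ t :* p :* (t :* h)) refl θ (rejectAll (k₁ + b)) p (acceptMax (k₁ + b)) ⟩
    θ * rejectAll (k₁ + b) +ℚ θ * p * (θ * acceptMax (k₁ + b))
      ≡⟨ cong₂ (λ z h → θ * z +ℚ θ * p * h) (rejectAll-middle b (ℕP.≤-pred b≤a)) (acceptMax-middle b (ℕP.m≤n⇒m≤1+n (ℕP.≤-pred b≤a))) ⟩
    θ * (pow θ b * P θ k₁ * f) +ℚ θ * p * (pow θ b * P θ k₁ * f * recipSum b)
      ≡⟨ cong (_+ℚ θ * p * (pow θ b * P θ k₁ * f * recipSum b)) (*-P*P⁻¹ (q + b) (θ * (pow θ b * P θ k₁ * f))) ⟨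
    θ * (pow θ b * P θ k₁ * f) * (p * P⁻¹ (k₁ + b)) +ℚ θ * p * (pow θ b * P θ k₁ * f * recipSum b)
      ≡⟨ solve 7 (λ t e k f p s r → t :* (e :* k :* f) :* (p :* r) :+ t :* p :* (e :* k :* f :* s) := t :* e :* k :* (p :* f) :* (s :+ r)) refl
               θ (pow θ b) (P θ k₁) f p (recipSum b) (P⁻¹ (k₁ + b)) ⟩
    pow θ (suc b) * P θ k₁ * P! θ (k₁ + b) * (recipSum b +ℚ P⁻¹ (k₁ + b))
      ≡⟨ cong (pow θ (suc b) * P θ k₁ * P! θ (k₁ + b) *_) (Σ<-suc b (λ j → P⁻¹ (k₁ + j))) ⟨
    pow θ (suc b) * P θ k₁ * P! θ (k₁ + b) * recipSum (suc b) ∎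
    where
    open ≡-Reasoning
    p = P θ (k₁ + b)
    f = P! θ (q + b)

  acceptSecond-early : ∀ m → m ≤ k₁ → acceptSecond m ≡ 0ℚ
  acceptSecond-early zero          _      = refl
  acceptSecond-early (suc zero)    _      = refl
  acceptSecond-early (suc (suc m)) 2+m≤k₁ = begin
    acceptSecond (suc (suc m))
      ≡⟨ acceptSecond-step m (ℕP.≤-trans 2+m≤k₁ k₁≤k₂) ⟩
    acceptMax (suc m) +ℚ θ * (θ * (P θ m * acceptSecond (suc m)))
      ≡⟨ cong₂ (λ h h′ → h +ℚ θ * (θ * (P θ m * h′))) (acceptMax-early (suc m) 1+m≤k₁) (acceptSecond-early (suc m) 1+m≤k₁) ⟩
    0ℚ +ℚ θ * (θ * (P θ m * 0ℚ))
      ≡⟨ solve 2 (λ t p → con 0ℚ :+ t :* (t :* (p :* con 0ℚ)) := con 0ℚ) refl θ (P θ m) ⟩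
    0ℚ ∎
    where
    open ≡-Reasoning
    1+m≤k₁ = ℕP.≤-trans (ℕP.n≤1+n (suc m)) 2+m≤k₁

  ratioSum-suc : ∀ b → ratioSum (suc b) ≡ recipSum (suc b) +ℚ θ * ratioSum b
  ratioSum-suc b = trans (Σ<-P-suc θ b (suc b) (λ j → P⁻¹ (k₁ + j)) ℕP.≤-refl)
                         (cong (λ s → recipSum (suc b) +ℚ θ * s) (Σ<-P-last θ b (λ j → P⁻¹ (k₁ + j))))

  P!-peel : ∀ n → P! θ n ≡ P! θ (suc (suc n)) * P⁻¹ (suc (suc n)) * P⁻¹ (suc n)
  P!-peel n = begin
    P! θ n
      ≡⟨ *-P*P⁻¹ n (P! θ n) ⟨
    P! θ n * (P θ (suc n) * P⁻¹ (suc n))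
      ≡⟨ *-P*P⁻¹ (suc n) _ ⟨
    P! θ n * (P θ (suc n) * P⁻¹ (suc n)) * (P θ (suc (suc n)) * P⁻¹ (suc (suc n)))
      ≡⟨ solve 5 (λ f p r p′ r′ → f :* (p :* r) :* (p′ :* r′) := p′ :* (p :* f) :* r′ :* r) refl
               (P! θ n) (P θ (suc n)) (P⁻¹ (suc n)) (P θ (suc (suc n))) (P⁻¹ (suc (suc n))) ⟩
    P! θ (suc (suc n)) * P⁻¹ (suc (suc n)) * P⁻¹ (suc n) ∎
    where open ≡-Reasoning

  acceptMax-late : ∀ e → θ * acceptMax (suc (k₂ + e)) ≡
    pow θ (suc a) * pow θ e * P θ k₁ * P! θ (k₂ + e) * (recipSum (suc a) +ℚ P θ (q + a) * crossSum e)
  acceptMax-late zero = begin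
    θ * acceptMax (suc (k₂ + 0))
      ≡⟨ subst (λ n → θ * acceptMax (suc n) ≡ pow θ (suc a) * P θ k₁ * P! θ n * recipSum (suc a))
               (trans (ℕP.+-suc q a) (cong suc (sym (ℕP.+-identityʳ (q + a))))) (acceptMax-middle (suc a) ℕP.≤-refl) ⟩
    pow θ (suc a) * P θ k₁ * P! θ (k₂ + 0) * recipSum (suc a)
      ≡⟨ solve 5 (λ e k f s p → e :* k :* f :* s := e :* con 1ℚ :* k :* f :* (s :+ p :* con 0ℚ)) refl
               (pow θ (suc a)) (P θ k₁) (P! θ (k₂ + 0)) (recipSum (suc a)) (P θ (q + a)) ⟩
    pow θ (suc a) * pow θ 0 * P θ k₁ * P! θ (k₂ + 0) * (recipSum (suc a) +ℚ P θ (q + a) * crossSum 0) ∎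
    where open ≡-Reasoning
  acceptMax-late (suc e) = begin
    θ * acceptMax (suc (k₂ + suc e))
      ≡⟨ cong (λ n → θ * acceptMax (suc (suc n))) (ℕP.+-suc (q + a) e) ⟩
    θ * acceptMax (suc m)
      ≡⟨ cong (θ *_) (acceptMax-step m (k₁<2+k₂+ e)) ⟩
    θ * (rejectAll m +ℚ θ * (p * acceptMax m))
      ≡⟨ solve 4 (λ t z p h → t :* (z :+ t :* (p :* h)) := t :* z :+ t :* p :* (t :* h)) refl θ (rejectAll m) p (acceptMax m) ⟩
    θ * rejectAll m +ℚ θ * p * (θ * acceptMax m)
      ≡⟨ cong₂ (λ z h → θ * z +ℚ θ * p * h) rejectAll-m (acceptMax-late e) ⟩
    θ * (Z * (P! θ m * P⁻¹ m * P⁻¹ (k₂ + e))) +ℚ θ * p * (pow θ (suc a) * pow θ e * P θ k₁ * F * (A +ℚ pa * crossSum e))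
      ≡⟨ solve 11 (λ t ea ee k pa p F A c r₂ r₁ →
                     t :* (ea :* (t :* ee) :* (t :* ee) :* k :* pa :* ((p :* F) :* r₂ :* r₁)) :+ t :* p :* ((t :* ea) :* ee :* k :* F :* (A :+ pa :* c))
                  := (t :* ea) :* (t :* ee) :* k :* (p :* F) :* (A :+ pa :* (c :+ (t :* ee) :* r₂ :* r₁))) refl
               θ (pow θ a) (pow θ e) (P θ k₁) pa p F A (crossSum e) (P⁻¹ m) (P⁻¹ (k₂ + e)) ⟩
    pow θ (suc a) * pow θ (suc e) * P θ k₁ * P! θ m * (A +ℚ pa * (crossSum e +ℚ pow θ (suc e) * P⁻¹ m * P⁻¹ (k₂ + e)))
      ≡⟨ cong (λ c → pow θ (suc a) * pow θ (suc e) * P θ k₁ * P! θ m * (A +ℚ pa * c))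
              (Σ<-suc e (λ j → pow θ (suc j) * P⁻¹ (suc (k₂ + j)) * P⁻¹ (k₂ + j))) ⟨
    pow θ (suc a) * pow θ (suc e) * P θ k₁ * P! θ m * (A +ℚ pa * crossSum (suc e))
      ≡⟨ cong (λ n → pow θ (suc a) * pow θ (suc e) * P θ k₁ * P! θ (suc n) * (A +ℚ pa * crossSum (suc e))) (ℕP.+-suc (q + a) e) ⟨
    pow θ (suc a) * pow θ (suc e) * P θ k₁ * P! θ (k₂ + suc e) * (A +ℚ pa * crossSum (suc e)) ∎
    where
    open ≡-Reasoning
    m = suc (k₂ + e)
    p = P θ m
    pa = P θ (q + a)
    F = P! θ (k₂ + e)
    A = recipSum (suc a)
    Z = pow θ a * pow θ (suc e) * pow θ (suc e) * P θ k₁ * pa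
    rejectAll-m : rejectAll m ≡ Z * (P! θ m * P⁻¹ m * P⁻¹ (k₂ + e))
    rejectAll-m = trans (rejectAll-late e) (cong (Z *_) (P!-peel (q + a + e)))

  -- The left-hand side is θ · acceptSecond (1 + k₁ + b) while 1 + k₁ + b ≤ k₂, and at b = a it is
  -- θ · win (1 + k₂) without its rejectAll term.
  acceptSecond-middle : ∀ b → b ≤ a →
    θ * acceptMax (k₁ + b) +ℚ θ * θ * P θ (q + b) * (θ * acceptSecond (k₁ + b)) ≡ pow θ b * P θ k₁ * P! θ (q + b) * ratioSum b
  acceptSecond-middle zero _ = begin
    θ * acceptMax (k₁ + 0) +ℚ θ * θ * P θ (q + 0) * (θ * acceptSecond (k₁ + 0))
      ≡⟨ cong₂ (λ h h′ → θ * h +ℚ θ * θ * P θ (q + 0) * (θ * h′)) (acceptMax-early (k₁ + 0) k₁+0≤k₁) (acceptSecond-early (k₁ + 0) k₁+0≤k₁) ⟩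
    θ * 0ℚ +ℚ θ * θ * P θ (q + 0) * (θ * 0ℚ)
      ≡⟨ solve 4 (λ t p k f → t :* con 0ℚ :+ t :* t :* p :* (t :* con 0ℚ) := con 1ℚ :* k :* f :* con 0ℚ) refl θ (P θ (q + 0)) (P θ k₁) (P! θ (q + 0)) ⟩
    pow θ 0 * P θ k₁ * P! θ (q + 0) * ratioSum 0 ∎
    where
    open ≡-Reasoning
    k₁+0≤k₁ = ℕP.≤-reflexive (cong suc (ℕP.+-identityʳ q))
  acceptSecond-middle (suc b) b<a = begin
    θ * acceptMax (k₁ + suc b) +ℚ θ * θ * P θ (q + suc b) * (θ * acceptSecond (k₁ + suc b))
      ≡⟨ cong (λ n → θ * acceptMax (suc n) +ℚ θ * θ * P θ n * (θ * acceptSecond (suc n))) (ℕP.+-suc q b) ⟩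
    θ * acceptMax (suc (k₁ + b)) +ℚ θ * θ * p * (θ * acceptSecond (suc (k₁ + b)))
      ≡⟨ cong (λ h → θ * acceptMax (suc (k₁ + b)) +ℚ θ * θ * p * (θ * h)) (acceptSecond-step (q + b) (1+k₁+≤k₂ b<a)) ⟩
    θ * acceptMax (suc (k₁ + b)) +ℚ θ * θ * p * (θ * (acceptMax (k₁ + b) +ℚ θ * (θ * (P θ (q + b) * acceptSecond (k₁ + b)))))
      ≡⟨ cong (λ h → θ * acceptMax (suc (k₁ + b)) +ℚ θ * θ * p * h)
              (solve 4 (λ t h p h′ → t :* (h :+ t :* (t :* (p :* h′))) := t :* h :+ t :* t :* p :* (t :* h′)) refl
                     θ (acceptMax (k₁ + b)) (P θ (q + b)) (acceptSecond (k₁ + b))) ⟩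
    θ * acceptMax (suc (k₁ + b)) +ℚ θ * θ * p * (θ * acceptMax (k₁ + b) +ℚ θ * θ * P θ (q + b) * (θ * acceptSecond (k₁ + b)))
      ≡⟨ cong₂ (λ h s → h +ℚ θ * θ * p * s) max-next (acceptSecond-middle b (ℕP.<⇒≤ b<a)) ⟩
    pow θ (suc b) * P θ k₁ * (p * f) * recipSum (suc b) +ℚ θ * θ * p * (pow θ b * P θ k₁ * f * ratioSum b)
      ≡⟨ solve 7 (λ t e k p f s r → (t :* e) :* k :* (p :* f) :* s :+ t :* t :* p :* (e :* k :* f :* r) := (t :* e) :* k :* (p :* f) :* (s :+ t :* r)) refl
               θ (pow θ b) (P θ k₁) p f (recipSum (suc b)) (ratioSum b) ⟩
    pow θ (suc b) * P θ k₁ * P! θ (k₁ + b) * (recipSum (suc b) +ℚ θ * ratioSum b)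
      ≡⟨ cong₂ (λ n s → pow θ (suc b) * P θ k₁ * P! θ n * s) (ℕP.+-suc q b) (ratioSum-suc b) ⟨
    pow θ (suc b) * P θ k₁ * P! θ (q + suc b) * ratioSum (suc b) ∎
    where
    open ≡-Reasoning
    p = P θ (k₁ + b)
    f = P! θ (q + b)
    max-next : θ * acceptMax (suc (k₁ + b)) ≡ pow θ (suc b) * P θ k₁ * P! θ (k₁ + b) * recipSum (suc b)
    max-next = subst (λ n → θ * acceptMax (suc n) ≡ pow θ (suc b) * P θ k₁ * P! θ n * recipSum (suc b))
                     (ℕP.+-suc q b) (acceptMax-middle (suc b) (ℕP.m≤n⇒m≤1+n b<a))

  lateRecipSum lateRatioSum lateCrossSum : ℕ → ℚ
  lateRecipSum d = Σ< (suc d) (λ j → P⁻¹ (k₂ + j))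
  lateRatioSum d = Σ< (suc a) (λ j → P θ (suc (a + d) ∸ j) * P⁻¹ (k₁ + j))
  lateCrossSum d = Σ< d (λ j → P θ (d ∸ j) * (pow θ j * (P⁻¹ (suc (k₂ + j)) * P⁻¹ (k₂ + j))))

  -- The bracketed factor of the theorem for N = k₂ + 1 + d.
  bracket : ℕ → ℚ
  bracket zero    = θ * θ +ℚ ratioSum a
  bracket (suc d) = pow θ (3 + d) +ℚ pow θ (3 + d) * P θ (q + a) * lateRecipSum d +ℚ lateRatioSum d +ℚ θ * P θ (q + a) * lateCrossSum d

  lateRatioSum-zero : lateRatioSum 0 ≡ ratioSum (suc a)
  lateRatioSum-zero = Σ<-cong (suc a) (λ j _ → cong (λ n → P θ (suc n ∸ j) * P⁻¹ (k₁ + j)) (ℕP.+-identityʳ a))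

  lateRatioSum-suc : ∀ d → lateRatioSum (suc d) ≡ recipSum (suc a) +ℚ θ * lateRatioSum d
  lateRatioSum-suc d =
    trans (Σ<-cong (suc a) (λ j _ → cong (λ n → P θ (suc n ∸ j) * P⁻¹ (k₁ + j)) (ℕP.+-suc a d)))
          (Σ<-P-suc θ (suc (a + d)) (suc a) (λ j → P⁻¹ (k₁ + j)) (s≤s (ℕP.m≤n⇒m≤1+n (ℕP.m≤m+n a d))))

  lateCrossSum-suc : ∀ d → θ * lateCrossSum (suc d) ≡ crossSum (suc d) +ℚ θ * (θ * lateCrossSum d)
  lateCrossSum-suc d = begin
    θ * lateCrossSum (suc d)
      ≡⟨ cong (θ *_) (Σ<-P-suc θ d (suc d) c ℕP.≤-refl) ⟩
    θ * (Σ< (suc d) c +ℚ θ * Σ< (suc d) (λ j → P θ (d ∸ j) * c j))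
      ≡⟨ cong (λ s → θ * (Σ< (suc d) c +ℚ θ * s)) (Σ<-P-last θ d c) ⟩
    θ * (Σ< (suc d) c +ℚ θ * lateCrossSum d)
      ≡⟨ ℚP.*-distribˡ-+ θ (Σ< (suc d) c) _ ⟩
    θ * Σ< (suc d) c +ℚ θ * (θ * lateCrossSum d)
      ≡⟨ cong (_+ℚ θ * (θ * lateCrossSum d)) (trans (sym (Σ<-*ˡ (suc d) θ c)) (Σ<-cong (suc d) (λ j _ → reassociate j))) ⟩
    crossSum (suc d) +ℚ θ * (θ * lateCrossSum d) ∎
    where
    open ≡-Reasoning
    c : ℕ → ℚ
    c j = pow θ j * (P⁻¹ (suc (k₂ + j)) * P⁻¹ (k₂ + j))
    reassociate : ∀ j → θ * c j ≡ pow θ (suc j) * P⁻¹ (suc (k₂ + j)) * P⁻¹ (k₂ + j)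
    reassociate j =
      solve 4 (λ t e r₂ r₁ → t :* (e :* (r₂ :* r₁)) := t :* e :* r₂ :* r₁) refl θ (pow θ j) (P⁻¹ (suc (k₂ + j))) (P⁻¹ (k₂ + j))

  bracket-suc : ∀ d → bracket (suc d) ≡
    recipSum (suc a) +ℚ P θ (q + a) * crossSum d +ℚ pow θ (3 + d) * P θ (q + a) * P⁻¹ (k₂ + d) +ℚ θ * bracket d
  bracket-suc zero = begin
    bracket 1
      ≡⟨ cong (λ s → θ³ +ℚ θ³ * pa * (P⁻¹ (k₂ + 0) +ℚ 0ℚ) +ℚ s +ℚ θ * pa * 0ℚ) (trans lateRatioSum-zero (ratioSum-suc a)) ⟩
    θ³ +ℚ θ³ * pa * (P⁻¹ (k₂ + 0) +ℚ 0ℚ) +ℚ (recipSum (suc a) +ℚ θ * ratioSum a) +ℚ θ * pa * 0ℚ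
      ≡⟨ solve 5 (λ t p r s b → t :* (t :* (t :* con 1ℚ)) :+ t :* (t :* (t :* con 1ℚ)) :* p :* (r :+ con 0ℚ) :+ (s :+ t :* b) :+ t :* p :* con 0ℚ
                             := s :+ p :* con 0ℚ :+ t :* (t :* (t :* con 1ℚ)) :* p :* r :+ t :* (t :* t :+ b)) refl
               θ pa (P⁻¹ (k₂ + 0)) (recipSum (suc a)) (ratioSum a) ⟩
    recipSum (suc a) +ℚ pa * crossSum 0 +ℚ θ³ * pa * P⁻¹ (k₂ + 0) +ℚ θ * bracket 0 ∎
    where
    open ≡-Reasoning
    pa = P θ (q + a)
    θ³ = pow θ 3
  bracket-suc (suc d) = begin
    bracket (suc (suc d))
      ≡⟨ cong₂ (λ r s → θ * e +ℚ θ * e * pa * r +ℚ s +ℚ θ * pa * lateCrossSum (suc d)) (Σ<-suc (suc d) (λ j → P⁻¹ (k₂ + j))) (lateRatioSum-suc d) ⟩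
    θ * e +ℚ θ * e * pa * (lateRecipSum d +ℚ P⁻¹ (k₂ + suc d)) +ℚ (A +ℚ θ * lateRatioSum d) +ℚ θ * pa * lateCrossSum (suc d)
      ≡⟨ solve 8 (λ t e p l r A m c → t :* e :+ t :* e :* p :* (l :+ r) :+ (A :+ t :* m) :+ t :* p :* c
                                   := t :* e :+ t :* e :* p :* (l :+ r) :+ (A :+ t :* m) :+ p :* (t :* c)) refl
               θ e pa (lateRecipSum d) (P⁻¹ (k₂ + suc d)) A (lateRatioSum d) (lateCrossSum (suc d)) ⟩
    θ * e +ℚ θ * e * pa * (lateRecipSum d +ℚ P⁻¹ (k₂ + suc d)) +ℚ (A +ℚ θ * lateRatioSum d) +ℚ pa * (θ * lateCrossSum (suc d))
      ≡⟨ cong (λ c → θ * e +ℚ θ * e * pa * (lateRecipSum d +ℚ P⁻¹ (k₂ + suc d)) +ℚ (A +ℚ θ * lateRatioSum d) +ℚ pa * c) (lateCrossSum-suc d) ⟩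
    θ * e +ℚ θ * e * pa * (lateRecipSum d +ℚ P⁻¹ (k₂ + suc d)) +ℚ (A +ℚ θ * lateRatioSum d) +ℚ pa * (crossSum (suc d) +ℚ θ * (θ * lateCrossSum d))
      ≡⟨ solve 9 (λ t e p l r A m C c → t :* e :+ t :* e :* p :* (l :+ r) :+ (A :+ t :* m) :+ p :* (C :+ t :* (t :* c))
                                     := A :+ p :* C :+ t :* e :* p :* r :+ t :* (e :+ e :* p :* l :+ m :+ t :* p :* c)) refl
               θ e pa (lateRecipSum d) (P⁻¹ (k₂ + suc d)) A (lateRatioSum d) (crossSum (suc d)) (lateCrossSum d) ⟩
    A +ℚ pa * crossSum (suc d) +ℚ θ * e * pa * P⁻¹ (k₂ + suc d) +ℚ θ * bracket (suc d) ∎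
    where
    open ≡-Reasoning
    pa = P θ (q + a)
    e = pow θ (3 + d)
    A = recipSum (suc a)

  win-late : ∀ d → θ * win (suc (k₂ + d)) ≡ pow θ a * pow θ d * P θ k₁ * P! θ (q + a + d) * bracket d
  win-late zero = begin
    θ * win (suc (k₂ + 0))
      ≡⟨ cong (λ n → θ * win (suc (suc n))) (ℕP.+-identityʳ (q + a)) ⟩
    θ * (acceptMax k₂ +ℚ θ * (rejectAll k₂ +ℚ θ * (pa * acceptSecond k₂)))
      ≡⟨ solve 5 (λ t h z p s → t :* (h :+ t :* (z :+ t :* (p :* s))) := (t :* h :+ t :* t :* p :* (t :* s)) :+ t :* t :* z) refl
               θ (acceptMax k₂) (rejectAll k₂) pa (acceptSecond k₂) ⟩
    (θ * acceptMax k₂ +ℚ θ * θ * pa * (θ * acceptSecond k₂)) +ℚ θ * θ * rejectAll k₂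
      ≡⟨ cong₂ (λ s z → s +ℚ θ * θ * z) (acceptSecond-middle a ℕP.≤-refl) (rejectAll-middle a ℕP.≤-refl) ⟩
    pow θ a * P θ k₁ * F * ratioSum a +ℚ θ * θ * (pow θ a * P θ k₁ * F)
      ≡⟨ solve 5 (λ t e k f b → e :* k :* f :* b :+ t :* t :* (e :* k :* f) := e :* con 1ℚ :* k :* f :* (t :* t :+ b)) refl
               θ (pow θ a) (P θ k₁) F (ratioSum a) ⟩
    pow θ a * pow θ 0 * P θ k₁ * F * bracket 0
      ≡⟨ cong (λ n → pow θ a * pow θ 0 * P θ k₁ * P! θ n * bracket 0) (ℕP.+-identityʳ (q + a)) ⟨
    pow θ a * pow θ 0 * P θ k₁ * P! θ (q + a + 0) * bracket 0 ∎
    where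
    open ≡-Reasoning
    pa = P θ (q + a)
    F = P! θ (q + a)
  win-late (suc d) = begin
    θ * win (suc (k₂ + suc d))
      ≡⟨ cong (λ n → θ * win (suc (suc n))) (ℕP.+-suc (q + a) d) ⟩
    θ * (acceptMax m +ℚ θ * (rejectAll m +ℚ θ * (p * acceptSecond m)))
      ≡⟨ cong (λ s → θ * (acceptMax m +ℚ θ * (rejectAll m +ℚ θ * (p * s)))) (win-late-step (q + a + d) (s≤s (ℕP.m≤m+n k₂ d))) ⟨
    θ * (acceptMax m +ℚ θ * (rejectAll m +ℚ θ * (p * win m)))
      ≡⟨ solve 5 (λ t h z p w → t :* (h :+ t :* (z :+ t :* (p :* w))) := t :* h :+ t :* t :* z :+ t :* t :* p :* (t :* w)) refl
               θ (acceptMax m) (rejectAll m) p (win m) ⟩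
    θ * acceptMax m +ℚ θ * θ * rejectAll m +ℚ θ * θ * p * (θ * win m)
      ≡⟨ cong₂ (λ h w → h +ℚ θ * θ * rejectAll m +ℚ θ * θ * p * w) (acceptMax-late d) (win-late d) ⟩
    X +ℚ θ * θ * rejectAll m +ℚ θ * θ * p * (pow θ a * pow θ d * P θ k₁ * F * bracket d)
      ≡⟨ cong (λ z → X +ℚ θ * θ * z +ℚ θ * θ * p * (pow θ a * pow θ d * P θ k₁ * F * bracket d)) rejectAll-m ⟩
    X +ℚ θ * θ * (Z * (p * P⁻¹ (k₂ + d))) +ℚ θ * θ * p * (pow θ a * pow θ d * P θ k₁ * F * bracket d)
      ≡⟨ solve 11 (λ t ea ed k p F A pa c r b →
                     (t :* ea) :* ed :* k :* (p :* F) :* (A :+ pa :* c)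
                       :+ t :* t :* (ea :* (t :* ed) :* (t :* ed) :* k :* pa :* F :* (p :* r)) :+ t :* t :* p :* (ea :* ed :* k :* F :* b)
                  := ea :* (t :* ed) :* k :* (p :* F) :* (A :+ pa :* c :+ t :* (t :* (t :* ed)) :* pa :* r :+ t :* b)) refl
               θ (pow θ a) (pow θ d) (P θ k₁) p F A pa (crossSum d) (P⁻¹ (k₂ + d)) (bracket d) ⟩
    pow θ a * pow θ (suc d) * P θ k₁ * P! θ (k₂ + d) * (A +ℚ pa * crossSum d +ℚ pow θ (3 + d) * pa * P⁻¹ (k₂ + d) +ℚ θ * bracket d)
      ≡⟨ cong₂ (λ n b → pow θ a * pow θ (suc d) * P θ k₁ * P! θ n * b) (ℕP.+-suc (q + a) d) (bracket-suc d) ⟨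
    pow θ a * pow θ (suc d) * P θ k₁ * P! θ (q + a + suc d) * bracket (suc d) ∎
    where
    open ≡-Reasoning
    m = suc (k₂ + d)
    p = P θ (k₂ + d)
    pa = P θ (q + a)
    F = P! θ (q + a + d)
    A = recipSum (suc a)
    X = pow θ (suc a) * pow θ d * P θ k₁ * (p * F) * (A +ℚ pa * crossSum d)
    Z = pow θ a * pow θ (suc d) * pow θ (suc d) * P θ k₁ * pa * F
    rejectAll-m : rejectAll m ≡ Z * (p * P⁻¹ (k₂ + d))
    rejectAll-m = trans (rejectAll-late d) (sym (*-P*P⁻¹ (q + a + d) Z))

  θ*W₁≡bracket : ∀ d → θ * W₁ θ (suc (k₂ + d)) k₁ k₂ ≡ pow θ a * pow θ d * P θ k₁ * P! θ (q + a + d) * bracket d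
  θ*W₁≡bracket d = trans (cong (θ *_) (W₁≡win θ k₁ k₂ (q + a + d))) (win-late d)

  W₁-at-k₂+1 : W₁ θ (k₂ + 1) k₁ k₂ ≡
    P! θ (k₂ ∸ 1) * P θ k₁ * powℤ θ ((+ k₂ - + k₁) - + 1) *
      (pow θ 2 +ℚ Σ[ k₁ to k₂ ∸ 1 ] (λ i → P θ (k₂ ∸ i) * recip (P θ i)))
  W₁-at-k₂+1 = *-cancelˡ-≢0 θ θ≢0 (begin
    θ * W₁ θ (k₂ + 1) k₁ k₂
      ≡⟨ cong (λ n → θ * W₁ θ n k₁ k₂) (trans (ℕP.+-comm k₂ 1) (cong suc (sym (ℕP.+-identityʳ k₂)))) ⟩
    θ * W₁ θ (suc (k₂ + 0)) k₁ k₂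
      ≡⟨ θ*W₁≡bracket 0 ⟩
    pow θ a * pow θ 0 * P θ k₁ * P! θ (q + a + 0) * (θ * θ +ℚ ratioSum a)
      ≡⟨ cong₂ (λ e n → e * pow θ 0 * P θ k₁ * P! θ n * (θ * θ +ℚ ratioSum a)) (pow≡θ*powℤ[-1] a) (ℕP.+-identityʳ (q + a)) ⟩
    θ * powℤ θ (a ⊖ 1) * pow θ 0 * P θ k₁ * P! θ (q + a) * (θ * θ +ℚ ratioSum a)
      ≡⟨ solve 5 (λ t z k f b → t :* z :* con 1ℚ :* k :* f :* (t :* t :+ b) := t :* (f :* k :* z :* (t :* (t :* con 1ℚ) :+ b))) refl
               θ (powℤ θ (a ⊖ 1)) (P θ k₁) (P! θ (q + a)) (ratioSum a) ⟩
    θ * (P! θ (q + a) * P θ k₁ * powℤ θ (a ⊖ 1) * (pow θ 2 +ℚ ratioSum a))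
      ≡⟨ cong₂ (λ z s → θ * (P! θ (q + a) * P θ k₁ * powℤ θ z * (pow θ 2 +ℚ s))) exponent sum ⟨
    θ * (P! θ (k₂ ∸ 1) * P θ k₁ * powℤ θ ((+ k₂ - + k₁) - + 1) *
           (pow θ 2 +ℚ Σ[ k₁ to k₂ ∸ 1 ] (λ i → P θ (k₂ ∸ i) * recip (P θ i)))) ∎)
    where
    open ≡-Reasoning
    exponent : (+ k₂ - + k₁) - + 1 ≡ a ⊖ 1
    exponent = trans (cong (_- + 1) (trans (ℤP.[1+m]⊖[1+n]≡m⊖n (q + a) q) (trans (ℤP.⊖-≥ (ℕP.m≤m+n q a)) (cong +_ (ℕP.m+n∸m≡n q a)))))
                     (ℤP.m-n≡m⊖n a 1)
    sum : Σ[ k₁ to k₂ ∸ 1 ] (λ i → P θ (k₂ ∸ i) * recip (P θ i)) ≡ ratioSum a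
    sum = Σ[]-as-Σ< k₁ (k₂ ∸ 1) (λ i → P θ (k₂ ∸ i) * recip (P θ i)) _ (ℕP.m+n∸m≡n q a)
            (λ j → cong (λ n → P θ n * P⁻¹ (k₁ + j)) (ℕP.[m+n]∸[m+o]≡n∸o q a j))

  k₂+2∸k₁∸2 : k₂ + 2 ∸ k₁ ∸ 2 ≡ a
  k₂+2∸k₁∸2 = begin
    q + a + 2 ∸ q ∸ 2    ≡⟨ cong (λ n → n ∸ q ∸ 2) (ℕP.+-assoc q a 2) ⟩
    q + (a + 2) ∸ q ∸ 2  ≡⟨ cong (_∸ 2) (ℕP.m+n∸m≡n q (a + 2)) ⟩
    a + 2 ∸ 2            ≡⟨ ℕP.m+n∸n≡m a 2 ⟩
    a                       ∎
    where open ≡-Reasoning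

  Σ-ratio-at-k₂+2 : Σ[ k₁ to k₂ ] (λ i → P θ (k₂ + 2 ∸ i ∸ 1) * recip (P θ i)) ≡ lateRatioSum 0
  Σ-ratio-at-k₂+2 = Σ[]-as-Σ< k₁ k₂ (λ i → P θ (k₂ + 2 ∸ i ∸ 1) * recip (P θ i)) _
    (trans (cong (_∸ q) (sym (ℕP.+-suc q a))) (ℕP.m+n∸m≡n q (suc a)))
    (λ j → cong (λ n → P θ n * P⁻¹ (k₁ + j)) (begin
      q + a + 2 ∸ (q + j) ∸ 1    ≡⟨ cong (λ n → n ∸ (q + j) ∸ 1) (ℕP.+-assoc q a 2) ⟩
      q + (a + 2) ∸ (q + j) ∸ 1  ≡⟨ cong (_∸ 1) (ℕP.[m+n]∸[m+o]≡n∸o q (a + 2) j) ⟩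
      a + 2 ∸ j ∸ 1              ≡⟨ ℕP.∸-+-assoc (a + 2) j 1 ⟩
      a + 2 ∸ (j + 1)            ≡⟨ cong₂ _∸_ (ℕP.+-comm a 2) (ℕP.+-comm j 1) ⟩
      suc a ∸ j                  ≡⟨ cong (λ n → suc n ∸ j) (ℕP.+-identityʳ a) ⟨
      suc (a + 0) ∸ j            ∎))
    where open ≡-Reasoning

  θ*W₁-at-k₂+2 : θ * W₁ θ (k₂ + 2) k₁ k₂ ≡
    θ * (pow θ a * P θ k₁ * P! θ k₂ * (pow θ 3 +ℚ pow θ 3 * P θ (q + a) * P⁻¹ k₂ +ℚ lateRatioSum 0))
  θ*W₁-at-k₂+2 = begin
    θ * W₁ θ (k₂ + 2) k₁ k₂
      ≡⟨ cong (λ n → θ * W₁ θ n k₁ k₂) (ℕP.+-suc k₂ 1) ⟩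
    θ * W₁ θ (suc (k₂ + 1)) k₁ k₂
      ≡⟨ θ*W₁≡bracket 1 ⟩
    pow θ a * pow θ 1 * P θ k₁ * P! θ (q + a + 1) * bracket 1
      ≡⟨ cong₂ (λ n m → pow θ a * pow θ 1 * P θ k₁ * P! θ n * (θ³ +ℚ θ³ * pa * (P⁻¹ m +ℚ 0ℚ) +ℚ lateRatioSum 0 +ℚ θ * pa * 0ℚ))
               (ℕP.+-comm (q + a) 1) (ℕP.+-identityʳ k₂) ⟩
    pow θ a * pow θ 1 * P θ k₁ * P! θ k₂ * (θ³ +ℚ θ³ * pa * (P⁻¹ k₂ +ℚ 0ℚ) +ℚ lateRatioSum 0 +ℚ θ * pa * 0ℚ)
      ≡⟨ solve 8 (λ t e k f c p r s → e :* (t :* con 1ℚ) :* k :* f :* (c :+ c :* p :* (r :+ con 0ℚ) :+ s :+ t :* p :* con 0ℚ)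
                                   := t :* (e :* k :* f :* (c :+ c :* p :* r :+ s))) refl
               θ (pow θ a) (P θ k₁) (P! θ k₂) θ³ pa (P⁻¹ k₂) (lateRatioSum 0) ⟩
    θ * (pow θ a * P θ k₁ * P! θ k₂ * (θ³ +ℚ θ³ * pa * P⁻¹ k₂ +ℚ lateRatioSum 0)) ∎
    where
    open ≡-Reasoning
    pa = P θ (q + a)
    θ³ = pow θ 3

  W₁-at-k₂+2 : W₁ θ (k₂ + 2) k₁ k₂ ≡
    pow θ (k₂ + 2 ∸ k₁ ∸ 2) * P θ k₁ * P! θ (k₂ + 2 ∸ 2) *
      (pow θ (k₂ + 2 ∸ k₂ + 1) +ℚ pow θ (k₂ + 2 ∸ k₂ + 1) * P θ (k₂ ∸ 1) * recip (P θ k₂)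
       +ℚ Σ[ k₁ to k₂ ] (λ i → P θ (k₂ + 2 ∸ i ∸ 1) * recip (P θ i)))
  W₁-at-k₂+2 = *-cancelˡ-≢0 θ θ≢0 (trans θ*W₁-at-k₂+2 (cong (θ *_) (begin
    shape a k₂ 3 (lateRatioSum 0)  ≡⟨ cong₂ (λ e f → shape e f 3 (lateRatioSum 0)) k₂+2∸k₁∸2 (ℕP.m+n∸n≡m k₂ 2) ⟨
    shape e f 3 (lateRatioSum 0)   ≡⟨ cong₂ (shape e f) (cong (_+ 1) (ℕP.m+n∸m≡n k₂ 2)) Σ-ratio-at-k₂+2 ⟨
    shape e f x Σ′                 ∎)))
    where
    open ≡-Reasoning
    shape : ℕ → ℕ → ℕ → ℚ → ℚ
    shape e f x s = pow θ e * P θ k₁ * P! θ f * (pow θ x +ℚ pow θ x * P θ (k₂ ∸ 1) * recip (P θ k₂) +ℚ s)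
    e f x : ℕ
    e = k₂ + 2 ∸ k₁ ∸ 2
    f = k₂ + 2 ∸ 2
    x = k₂ + 2 ∸ k₂ + 1
    Σ′ : ℚ
    Σ′ = Σ[ k₁ to k₂ ] (λ i → P θ (k₂ + 2 ∸ i ∸ 1) * recip (P θ i))

  N : ℕ → ℕ
  N d = suc (suc (suc (q + a + d)))

  N∸k₁∸2 : ∀ d → N d ∸ k₁ ∸ 2 ≡ a + d
  N∸k₁∸2 d = begin
    suc (suc (q + a + d)) ∸ q ∸ 2    ≡⟨ cong (λ n → suc (suc n) ∸ q ∸ 2) (ℕP.+-assoc q a d) ⟩
    suc (suc (q + (a + d))) ∸ q ∸ 2  ≡⟨ cong (_∸ 2) (ℕP.+-∸-assoc 2 (ℕP.m≤m+n q (a + d))) ⟩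
    suc (suc (q + (a + d) ∸ q)) ∸ 2  ≡⟨ ℕP.m+n∸m≡n q (a + d) ⟩
    a + d                            ∎
    where open ≡-Reasoning

  N∸k₂+1 : ∀ d → N d ∸ k₂ + 1 ≡ 3 + d
  N∸k₂+1 d = trans (cong (_+ 1) (trans (ℕP.+-∸-assoc 2 (ℕP.m≤m+n (q + a) d)) (cong (suc ∘ suc) (ℕP.m+n∸m≡n (q + a) d))))
                   (cong (suc ∘ suc) (ℕP.+-comm d 1))

  Σ-late-recip : ∀ d → Σ[ k₂ to N d ∸ 2 ] (λ i → recip (P θ i)) ≡ lateRecipSum d
  Σ-late-recip d = Σ[]-as-Σ< k₂ (N d ∸ 2) (λ i → recip (P θ i)) (λ j → P⁻¹ (k₂ + j))
    (trans (ℕP.+-∸-assoc 1 (ℕP.m≤m+n (q + a) d)) (cong suc (ℕP.m+n∸m≡n (q + a) d))) (λ _ → refl)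

  Σ-late-ratio : ∀ d → Σ[ k₁ to k₂ ] (λ i → P θ (N d ∸ i ∸ 1) * recip (P θ i)) ≡ lateRatioSum d
  Σ-late-ratio d = Σ[]-as-Σ< k₁ k₂ (λ i → P θ (N d ∸ i ∸ 1) * recip (P θ i)) _
    (trans (cong (_∸ q) (sym (ℕP.+-suc q a))) (ℕP.m+n∸m≡n q (suc a)))
    (λ j → cong (λ n → P θ n * P⁻¹ (k₁ + j)) (begin
      suc (suc (q + a + d)) ∸ (q + j) ∸ 1  ≡⟨ cong (λ n → n ∸ (q + j) ∸ 1) regroup ⟩
      q + suc (suc (a + d)) ∸ (q + j) ∸ 1  ≡⟨ cong (_∸ 1) (ℕP.[m+n]∸[m+o]≡n∸o q (suc (suc (a + d))) j) ⟩
      suc (suc (a + d)) ∸ j ∸ 1            ≡⟨ ℕP.∸-+-assoc (suc (suc (a + d))) j 1 ⟩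
      suc (suc (a + d)) ∸ (j + 1)          ≡⟨ cong (suc (suc (a + d)) ∸_) (ℕP.+-comm j 1) ⟩
      suc (a + d) ∸ j                      ∎))
    where
    open ≡-Reasoning
    regroup : suc (suc (q + a + d)) ≡ q + suc (suc (a + d))
    regroup = trans (cong (suc ∘ suc) (ℕP.+-assoc q a d)) (sym (trans (ℕP.+-suc q (suc (a + d))) (cong suc (ℕP.+-suc q (a + d)))))

  Σ-late-cross : ∀ d → Σ[ k₂ to N d ∸ 3 ] (λ i → pow θ (i ∸ k₂) * P θ (N d ∸ i ∸ 2) * recip (P θ i * P θ (i + 1))) ≡ lateCrossSum d
  Σ-late-cross d = Σ[]-as-Σ< k₂ (N d ∸ 3) (λ i → pow θ (i ∸ k₂) * P θ (N d ∸ i ∸ 2) * recip (P θ i * P θ (i + 1))) _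
    (ℕP.m+n∸m≡n (q + a) d)
    (λ j → trans (cong₂ _*_ (cong₂ (λ e n → pow θ e * P θ n) (ℕP.m+n∸m≡n k₂ j) (remaining j)) (recip-adjacent j))
                 (solve 3 (λ e p r → e :* p :* r := p :* (e :* r)) refl (pow θ j) (P θ (d ∸ j)) (P⁻¹ (suc (k₂ + j)) * P⁻¹ (k₂ + j))))
    where
    open ≡-Reasoning
    remaining : ∀ j → N d ∸ (k₂ + j) ∸ 2 ≡ d ∸ j
    remaining j = begin
      suc (suc (q + a + d)) ∸ (q + a + j) ∸ 2  ≡⟨ cong (λ n → n ∸ (q + a + j) ∸ 2) (sym (trans (ℕP.+-suc (q + a) (suc d)) (cong suc (ℕP.+-suc (q + a) d)))) ⟩
      q + a + suc (suc d) ∸ (q + a + j) ∸ 2    ≡⟨ cong (_∸ 2) (ℕP.[m+n]∸[m+o]≡n∸o (q + a) (suc (suc d)) j) ⟩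
      suc (suc d) ∸ j ∸ 2                      ≡⟨ ℕP.∸-+-assoc (suc (suc d)) j 2 ⟩
      suc (suc d) ∸ (j + 2)                    ≡⟨ cong (suc (suc d) ∸_) (ℕP.+-comm j 2) ⟩
      d ∸ j                                    ∎
    recip-adjacent : ∀ j → recip (P θ (k₂ + j) * P θ (k₂ + j + 1)) ≡ P⁻¹ (suc (k₂ + j)) * P⁻¹ (k₂ + j)
    recip-adjacent j = begin
      recip (P θ (k₂ + j) * P θ (k₂ + j + 1))    ≡⟨ cong (λ n → recip (P θ (k₂ + j) * P θ n)) (ℕP.+-comm (k₂ + j) 1) ⟩
      recip (P θ (k₂ + j) * P θ (suc (k₂ + j)))  ≡⟨ recip-* _ _ (P≢0 (q + a + j)) (P≢0 (k₂ + j)) ⟩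
      P⁻¹ (k₂ + j) * P⁻¹ (suc (k₂ + j))          ≡⟨ ℚP.*-comm (P⁻¹ (k₂ + j)) (P⁻¹ (suc (k₂ + j))) ⟩
      P⁻¹ (suc (k₂ + j)) * P⁻¹ (k₂ + j)          ∎

  θ*W₁-late : ∀ d → θ * W₁ θ (N d) k₁ k₂ ≡ θ * (pow θ (a + d) * P θ k₁ * P! θ (k₂ + d) * bracket (suc d))
  θ*W₁-late d = begin
    θ * W₁ θ (N d) k₁ k₂
      ≡⟨ cong (λ n → θ * W₁ θ (suc (suc n)) k₁ k₂) (ℕP.+-suc (q + a) d) ⟨
    θ * W₁ θ (suc (k₂ + suc d)) k₁ k₂
      ≡⟨ θ*W₁≡bracket (suc d) ⟩
    pow θ a * pow θ (suc d) * P θ k₁ * P! θ (q + a + suc d) * bracket (suc d)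
      ≡⟨ cong (λ n → pow θ a * pow θ (suc d) * P θ k₁ * P! θ n * bracket (suc d)) (ℕP.+-suc (q + a) d) ⟩
    pow θ a * pow θ (suc d) * P θ k₁ * P! θ (k₂ + d) * bracket (suc d)
      ≡⟨ solve 6 (λ t e₁ e₂ k f b → e₁ :* (t :* e₂) :* k :* f :* b := t :* (e₁ :* e₂ :* k :* f :* b)) refl
               θ (pow θ a) (pow θ d) (P θ k₁) (P! θ (k₂ + d)) (bracket (suc d)) ⟩
    θ * (pow θ a * pow θ d * P θ k₁ * P! θ (k₂ + d) * bracket (suc d))
      ≡⟨ cong (λ e → θ * (e * P θ k₁ * P! θ (k₂ + d) * bracket (suc d))) (pow-+ θ a d) ⟨
    θ * (pow θ (a + d) * P θ k₁ * P! θ (k₂ + d) * bracket (suc d)) ∎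
    where open ≡-Reasoning

  W₁-late : (n : ℕ) → k₂ ≤ n ∸ 3 → W₁ θ n k₁ k₂ ≡
    pow θ (n ∸ k₁ ∸ 2) * P θ k₁ * P! θ (n ∸ 2) *
      (pow θ (n ∸ k₂ + 1)
       +ℚ pow θ (n ∸ k₂ + 1) * P θ (k₂ ∸ 1) * Σ[ k₂ to n ∸ 2 ] (λ i → recip (P θ i))
       +ℚ Σ[ k₁ to k₂ ] (λ i → P θ (n ∸ i ∸ 1) * recip (P θ i))
       +ℚ θ * P θ (k₂ ∸ 1) * Σ[ k₂ to n ∸ 3 ] (λ i → pow θ (i ∸ k₂) * P θ (n ∸ i ∸ 2) * recip (P θ i * P θ (i + 1))))
  W₁-late (suc (suc (suc m))) k₂≤m with ℕP.m≤n⇒∃[o]m+o≡n (ℕP.<⇒≤ k₂≤m)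
  ... | d , refl = *-cancelˡ-≢0 θ θ≢0 (trans (θ*W₁-late d) (cong (θ *_) (begin
    shape (a + d) (3 + d) (lateRecipSum d) (lateRatioSum d) (lateCrossSum d)
      ≡⟨ cong₂ (λ e x → shape e x (lateRecipSum d) (lateRatioSum d) (lateCrossSum d)) (N∸k₁∸2 d) (N∸k₂+1 d) ⟨
    shape e x (lateRecipSum d) (lateRatioSum d) (lateCrossSum d)
      ≡⟨ cong₂ (λ s₁ s₂ → shape e x s₁ s₂ (lateCrossSum d)) (Σ-late-recip d) (Σ-late-ratio d) ⟨
    shape e x S₁ S₂ (lateCrossSum d)
      ≡⟨ cong (shape e x S₁ S₂) (Σ-late-cross d) ⟨
    shape e x S₁ S₂ S₃ ∎)))
    where
    open ≡-Reasoning
    shape : ℕ → ℕ → ℚ → ℚ → ℚ → ℚ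
    shape e x s₁ s₂ s₃ =
      pow θ e * P θ k₁ * P! θ (N d ∸ 2) * (pow θ x +ℚ pow θ x * P θ (k₂ ∸ 1) * s₁ +ℚ s₂ +ℚ θ * P θ (k₂ ∸ 1) * s₃)
    e x : ℕ
    e = N d ∸ k₁ ∸ 2
    x = N d ∸ k₂ + 1
    S₁ S₂ S₃ : ℚ
    S₁ = Σ[ k₂ to N d ∸ 2 ] (λ i → recip (P θ i))
    S₂ = Σ[ k₁ to k₂ ] (λ i → P θ (N d ∸ i ∸ 1) * recip (P θ i))
    S₃ = Σ[ k₂ to N d ∸ 3 ] (λ i → pow θ (i ∸ k₂) * P θ (N d ∸ i ∸ 2) * recip (P θ i * P θ (i + 1)))

theorem14 : (θ : ℚ) → 0ℚ < θ → (k₁ k₂ : ℕ) → 1 ≤ k₁ → k₁ ≤ k₂ →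
    ((N : ℕ) → k₂ ≤ N ∸ 3 →
      W₁ θ N k₁ k₂ ≡
        pow θ (N ∸ k₁ ∸ 2) * P θ k₁ * P! θ (N ∸ 2) *
          (pow θ (N ∸ k₂ + 1)
           +ℚ pow θ (N ∸ k₂ + 1) * P θ (k₂ ∸ 1) * Σ[ k₂ to N ∸ 2 ] (λ i → recip (P θ i))
           +ℚ Σ[ k₁ to k₂ ] (λ i → P θ (N ∸ i ∸ 1) * recip (P θ i))
           +ℚ θ * P θ (k₂ ∸ 1) *
                Σ[ k₂ to N ∸ 3 ] (λ i → pow θ (i ∸ k₂) * P θ (N ∸ i ∸ 2)
                                          * recip (P θ i * P θ (i + 1)))))
    ×
    (W₁ θ (k₂ + 1) k₁ k₂ ≡
       P! θ (k₂ ∸ 1) * P θ k₁ * powℤ θ ((+ k₂ - + k₁) - + 1) *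
         (pow θ 2 +ℚ Σ[ k₁ to k₂ ∸ 1 ] (λ i → P θ (k₂ ∸ i) * recip (P θ i))))
    ×
    (W₁ θ (k₂ + 2) k₁ k₂ ≡
       pow θ (k₂ + 2 ∸ k₁ ∸ 2) * P θ k₁ * P! θ (k₂ + 2 ∸ 2) *
         (pow θ (k₂ + 2 ∸ k₂ + 1)
          +ℚ pow θ (k₂ + 2 ∸ k₂ + 1) * P θ (k₂ ∸ 1) * recip (P θ k₂)
          +ℚ Σ[ k₁ to k₂ ] (λ i → P θ (k₂ + 2 ∸ i ∸ 1) * recip (P θ i))))
theorem14 θ θ>0 (suc q) k₂ _ k₁≤k₂ with ℕP.m≤n⇒∃[o]m+o≡n k₁≤k₂
... | a , refl = W₁-late , W₁-at-k₂+1 , W₁-at-k₂+2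
  where open ClosedForms θ θ>0 q a
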